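{- Let $\mathcal{R}=\mathbb{Z}_p[x_1,\dots,x_r,y_1,\dots,y_r]$ (independent variables) and for $1\le k\le r$ let $\mathcal{A}_k\in M_{k\times k(k+1)/2}(\mathcal{R})$ be the matrix with columns $y_1e_1^k,\dots,y_ke_k^k$ followed by the columns $q_{i,j}^k=-x_je_i^k+x_ie_j^k$ for $1\le i<j\le k$ (in lexicographic order), where $e_i^k$ is the standard basis of $\mathcal{R}^k$. Then every nonzero monomial of every $k\times k$ minor of $\mathcal{A}_k$ either equals $y_1y_2\cdots y_k$ or is divisible by $x_iy_i$ for some $1\le i\le k$. -}

module Defs where

open import Data.Nat as ℕ using (ℕ; zero; suc; _≤_)
open import Data.Integer as ℤ using (ℤ; +_; -_)
open import Data.Fin as Fin using (Fin; toℕ; punchIn; inject≤)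
open import Data.Fin.Properties using (_≟_)
open import Data.Vec as Vec using (Vec; tabulate; zipWith; replicate; lookup)
import Data.Vec.Properties as VecP
open import Data.List as List using (List; []; _∷_; _++_; concatMap; allFin; length)
open import Data.Product using (_×_; _,_; proj₁; proj₂; Σ)
open import Relation.Nullary using (yes; no)
import Relation.Nullary
import Relation.Nullary.Decidable
open import Relation.Binary.PropositionalEquality using (_≡_)
import Data.Nat.Properties as ℕP

-- Polynomials in x₁..x_r, y₁..y_r with integer coefficients.
-- A monomial is a pair (exponents of x, exponents of y).

Mon : ℕ → Set
Mon r = Vec ℕ r × Vec ℕ r

mon-dec : ∀ {r} (m m′ : Mon r) → Relation.Nullary.Dec (m ≡ m′)
mon-dec (a , b) (c , d) with VecP.≡-dec ℕP._≟_ a c | VecP.≡-dec ℕP._≟_ b d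
... | yes Relation.Binary.PropositionalEquality.refl | yes Relation.Binary.PropositionalEquality.refl = yes Relation.Binary.PropositionalEquality.refl
... | no ¬p | _ = no λ { Relation.Binary.PropositionalEquality.refl → ¬p Relation.Binary.PropositionalEquality.refl }
... | yes _ | no ¬q = no λ { Relation.Binary.PropositionalEquality.refl → ¬q Relation.Binary.PropositionalEquality.refl }

-- A polynomial is a formal sum of terms (coefficient, monomial); its
-- coefficient at a monomial is the sum of the coefficients of all
-- terms with that monomial.
Poly : ℕ → Set
Poly r = List (ℤ × Mon r)

coeff : ∀ {r} → Poly r → Mon r → ℤ
coeff [] m = + 0
coeff ((c , m′) ∷ p) m with mon-dec m′ m
... | yes _ = c ℤ.+ coeff p m
... | no _  = coeff p m

monMul : ∀ {r} → Mon r → Mon r → Mon r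
monMul (a , b) (c , d) = zipWith ℕ._+_ a c , zipWith ℕ._+_ b d

mon1 : ∀ {r} → Mon r
mon1 = replicate _ 0 , replicate _ 0

zeroP : ∀ {r} → Poly r
zeroP = []

oneP : ∀ {r} → Poly r
oneP = (+ 1 , mon1) ∷ []

_+P_ : ∀ {r} → Poly r → Poly r → Poly r
p +P q = p ++ q

_*P_ : ∀ {r} → Poly r → Poly r → Poly r
p *P q = concatMap (λ { (c , m) → List.map (λ { (d , n) → (c ℤ.* d , monMul m n) }) q }) p

negP : ∀ {r} → Poly r → Poly r
negP = List.map (λ { (c , m) → (- c , m) })

unitVec : ∀ {r} → Fin r → Vec ℕ r
unitVec i = tabulate (λ j → indicator (i ≟ j))
  where
  indicator : ∀ {P : Set} → Relation.Nullary.Dec P → ℕ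
  indicator (yes _) = 1
  indicator (no _)  = 0

xVar yVar : ∀ {r} → Fin r → Poly r
xVar i = (+ 1 , (unitVec i , replicate _ 0)) ∷ []
yVar i = (+ 1 , (replicate _ 0 , unitVec i)) ∷ []

sumP : ∀ {r n} → (Fin n → Poly r) → Poly r
sumP {n = zero}  f = zeroP
sumP {n = suc n} f = f Fin.zero +P sumP (λ j → f (Fin.suc j))

signP : ∀ {r} → ℕ → Poly r → Poly r
signP zero p = p
signP (suc zero) p = negP p
signP (suc (suc n)) p = signP n p

det : ∀ {r} n → (Fin n → Fin n → Poly r) → Poly r
det zero a = oneP
det (suc n) a =
  sumP (λ j → signP (toℕ j)
                (a Fin.zero j *P det n (λ i l → a (Fin.suc i) (punchIn j l))))

-- column descriptors: y_i e_i (ycol i) and q_{i,j} = -x_j e_i + x_i e_j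
data Col (k : ℕ) : Set where
  ycol : Fin k → Col k
  qcol : Fin k → Fin k → Col k

cols : (k : ℕ) → List (Col k)
cols k = List.map ycol (allFin k)
      ++ concatMap (λ i → concatMap (λ j → qs i j (i Fin.<? j)) (allFin k)) (allFin k)
  where
  qs : ∀ {P : Set} → Fin k → Fin k → Relation.Nullary.Dec P → List (Col k)
  qs i j (yes _) = qcol i j ∷ []
  qs i j (no _)  = []

N : ℕ → ℕ
N k = length (cols k)

-- entry in row l of a column; variable index i : Fin k is read as
-- the variable with the same index among x_1..x_r / y_1..y_r
colEntry : ∀ {r k} → k ≤ r → Col k → Fin k → Poly r
colEntry k≤r (ycol i) l with i ≟ l
... | yes _ = yVar (inject≤ i k≤r)
... | no _  = zeroP
colEntry k≤r (qcol i j) l with l ≟ i | l ≟ j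
... | yes _ | _     = negP (xVar (inject≤ j k≤r))
... | no _  | yes _ = xVar (inject≤ i k≤r)
... | no _  | no _  = zeroP

𝒜 : ∀ {r} k → k ≤ r → Fin k → Fin (N k) → Poly r
𝒜 k k≤r l c = colEntry k≤r (List.lookup (cols k) c) l

minor : ∀ {r} k → (k≤r : k ≤ r) → (Fin k → Fin (N k)) → Poly r
minor k k≤r c = det k (λ l m → 𝒜 k k≤r l (c m))

yProd : ∀ {r} k → k ≤ r → Mon r
yProd {r} k k≤r = replicate r 0 , tabulate (λ j → below (toℕ j ℕ.<? k))
  where
  below : ∀ {P : Set} → Relation.Nullary.Dec P → ℕ
  below (yes _) = 1
  below (no _)  = 0

-- Expand the minors of 𝒜_k one row at a time. For an injective choice ρ of rows and
-- any columns, every monomial of the minor is divisible by some x_i y_i, contains some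
-- x_j with j not a row, or is the product of the y_{ρ l}. Split the first row d into
-- its y-entry and its x-entries. The y-entry y_d multiplies a smaller minor, which
-- keeps this invariant. In the expansion along the x-entries, multiply them by x_d and
-- add x_{ρ l} times every other row l: the determinant does not change, and the new
-- row has x_i y_i in a column y_i e_i, and -x_i x_j + x_j x_i restricted to the rows in
-- a column q_{ij}, which cancels when i and j are both rows and otherwise contains an
-- x outside the rows. As no other row contains y_d, the factor x_d can be cancelled
-- again. With all k rows chosen no x lies outside, which leaves y_1 ⋯ y_k and the
-- multiples of x_i y_i.
{-# OPTIONS --safe #-}
module Submission where

open import Data.Nat using (ℕ; zero; suc; _≤_)
open import Data.Fin as Fin using (Fin; toℕ; punchIn; inject≤; _<_)
open import Algebra.Bundles using (CommutativeRing; CommutativeMonoid)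
open import Level using (0ℓ)
import Defs

module PolynomialRing {r : ℕ} where

  open import Defs
  open import Data.Integer using (ℤ; +_; -_; _+_; _*_)
  import Data.Integer.Properties as ℤP
  open import Data.Integer.Tactic.RingSolver using (solve-∀)
  import Data.Nat.Properties as ℕP
  import Data.Vec.Properties as VecP
  open import Data.List as List using ([]; _∷_; _++_)
  import Data.List.Properties as ListP
  open import Data.Nat as ℕ using ()
  open import Data.Vec as Vec using (Vec; []; _∷_; zipWith)
  open import Data.Product using (_×_; _,_; proj₁; proj₂)
  open import Relation.Binary.PropositionalEquality

  -- Formal sums are compared by their totals under every ℤ-weighting of the
  -- monomials: this is equality of coefficients, but weighing commutes with
  -- _++_ and _*P_ on the nose.
  weigh : (Mon r → ℤ) → Poly r → ℤ
  weigh f []            = + 0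
  weigh f ((c , m) ∷ p) = c * f m + weigh f p

  infix 4 _≈_
  record _≈_ (p q : Poly r) : Set where
    constructor weigh-ext
    field weigh-≡ : ∀ f → weigh f p ≡ weigh f q
  open _≈_ public

  ≈-refl : ∀ {p} → p ≈ p
  ≈-refl = weigh-ext λ f → refl

  ≈-sym : ∀ {p q} → p ≈ q → q ≈ p
  ≈-sym p≈q = weigh-ext λ f → sym (weigh-≡ p≈q f)

  ≈-trans : ∀ {p q s} → p ≈ q → q ≈ s → p ≈ s
  ≈-trans p≈q q≈s = weigh-ext λ f → trans (weigh-≡ p≈q f) (weigh-≡ q≈s f)

  weigh-++ : ∀ f (p q : Poly r) → weigh f (p ++ q) ≡ weigh f p + weigh f q
  weigh-++ f []            q = sym (ℤP.+-identityˡ _)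
  weigh-++ f ((c , m) ∷ p) q =
    trans (cong (_+_ (c * f m)) (weigh-++ f p q)) (sym (ℤP.+-assoc (c * f m) _ _))

  weigh-negP : ∀ f (p : Poly r) → weigh f (negP p) ≡ - weigh f p
  weigh-negP f []            = refl
  weigh-negP f ((c , m) ∷ p) = begin
    - c * f m + weigh f (negP p)   ≡⟨ cong₂ _+_ (sym (ℤP.neg-distribˡ-* c (f m))) (weigh-negP f p) ⟩
    - (c * f m) + - weigh f p      ≡⟨ sym (ℤP.neg-distrib-+ (c * f m) (weigh f p)) ⟩
    - (c * f m + weigh f p)        ∎
    where open ≡-Reasoning

  weigh-congˡ : ∀ {f g} → (∀ m → f m ≡ g m) → ∀ (p : Poly r) → weigh f p ≡ weigh g p
  weigh-congˡ f≗g []            = refl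
  weigh-congˡ f≗g ((c , m) ∷ p) = cong₂ _+_ (cong (c *_) (f≗g m)) (weigh-congˡ f≗g p)

  weigh-zeroˡ : ∀ (p : Poly r) → weigh (λ _ → + 0) p ≡ + 0
  weigh-zeroˡ []            = refl
  weigh-zeroˡ ((c , m) ∷ p) = cong₂ _+_ (ℤP.*-zeroʳ c) (weigh-zeroˡ p)

  weigh-+ˡ : ∀ f g (p : Poly r) → weigh (λ m → f m + g m) p ≡ weigh f p + weigh g p
  weigh-+ˡ f g []            = refl
  weigh-+ˡ f g ((c , m) ∷ p) =
    trans (cong (_+_ (c * (f m + g m))) (weigh-+ˡ f g p)) (lemma c (f m) (g m) (weigh f p) (weigh g p))
    where
    lemma : ∀ c a b x y → c * (a + b) + (x + y) ≡ (c * a + x) + (c * b + y)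
    lemma = solve-∀

  weigh-*ˡ : ∀ c f (p : Poly r) → weigh (λ m → c * f m) p ≡ c * weigh f p
  weigh-*ˡ c f []            = sym (ℤP.*-zeroʳ c)
  weigh-*ˡ c f ((d , m) ∷ p) =
    trans (cong (_+_ (d * (c * f m))) (weigh-*ˡ c f p)) (lemma c d (f m) (weigh f p))
    where
    lemma : ∀ c d a x → d * (c * a) + c * x ≡ c * (d * a + x)
    lemma = solve-∀

  weigh-comm : ∀ (h : Mon r → Mon r → ℤ) (p q : Poly r) →
               weigh (λ m → weigh (h m) q) p ≡ weigh (λ n → weigh (λ m → h m n) p) q
  weigh-comm h []            q = sym (weigh-zeroˡ q)
  weigh-comm h ((c , m) ∷ p) q = begin
    c * weigh (h m) q + weigh (λ m → weigh (h m) q) p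
      ≡⟨ cong₂ _+_ (sym (weigh-*ˡ c (h m) q)) (weigh-comm h p q) ⟩
    weigh (λ n → c * h m n) q + weigh (λ n → weigh (λ m → h m n) p) q
      ≡⟨ sym (weigh-+ˡ _ _ q) ⟩
    weigh (λ n → c * h m n + weigh (λ m → h m n) p) q
      ∎
    where open ≡-Reasoning

  weigh-*P : ∀ f (p q : Poly r) → weigh f (p *P q) ≡ weigh (λ m → weigh (λ n → f (monMul m n)) q) p
  weigh-*P f []            q = refl
  weigh-*P f ((c , m) ∷ p) q =
    trans (weigh-++ f (List.map (scale c m) q) (p *P q))
          (cong₂ _+_ (weigh-scale q) (weigh-*P f p q))
    where
    scale : ℤ → Mon r → ℤ × Mon r → ℤ × Mon r
    scale c m (d , n) = c * d , monMul m n
    weigh-scale : ∀ q → weigh f (List.map (scale c m) q) ≡ c * weigh (λ n → f (monMul m n)) q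
    weigh-scale []            = sym (ℤP.*-zeroʳ c)
    weigh-scale ((d , n) ∷ q) =
      trans (cong (_+_ (c * d * f (monMul m n))) (weigh-scale q)) (lemma c d (f (monMul m n)) _)
      where
      lemma : ∀ c d a x → c * d * a + c * x ≡ c * (d * a + x)
      lemma = solve-∀

  monMul-comm : ∀ (m n : Mon r) → monMul m n ≡ monMul n m
  monMul-comm (a , b) (c , d) =
    cong₂ _,_ (VecP.zipWith-comm ℕP.+-comm a c) (VecP.zipWith-comm ℕP.+-comm b d)

  monMul-assoc : ∀ (m n o : Mon r) → monMul (monMul m n) o ≡ monMul m (monMul n o)
  monMul-assoc (a , b) (c , d) (e , g) =
    cong₂ _,_ (VecP.zipWith-assoc ℕP.+-assoc a c e) (VecP.zipWith-assoc ℕP.+-assoc b d g)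

  monMul-identityˡ : ∀ (m : Mon r) → monMul mon1 m ≡ m
  monMul-identityˡ (a , b) =
    cong₂ _,_ (VecP.zipWith-identityˡ ℕP.+-identityˡ a) (VecP.zipWith-identityˡ ℕP.+-identityˡ b)

  monMul-cancelˡ : ∀ (a m n : Mon r) → monMul a m ≡ monMul a n → m ≡ n
  monMul-cancelˡ (a₁ , a₂) (m₁ , m₂) (n₁ , n₂) am≡an =
    cong₂ _,_ (zipWith-+-cancelˡ a₁ m₁ n₁ (cong proj₁ am≡an)) (zipWith-+-cancelˡ a₂ m₂ n₂ (cong proj₂ am≡an))
    where
    zipWith-+-cancelˡ : ∀ {n} (a b c : Vec ℕ n) → zipWith ℕ._+_ a b ≡ zipWith ℕ._+_ a c → b ≡ c
    zipWith-+-cancelˡ []       []       []       _   = refl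
    zipWith-+-cancelˡ (x ∷ a) (y ∷ b) (z ∷ c) eq =
      cong₂ _∷_ (ℕP.+-cancelˡ-≡ x y z (cong Vec.head eq)) (zipWith-+-cancelˡ a b c (cong Vec.tail eq))

  +P-cong : ∀ {p p′ q q′} → p ≈ p′ → q ≈ q′ → p +P q ≈ p′ +P q′
  +P-cong {p} {p′} {q} {q′} p≈p′ q≈q′ = weigh-ext λ f → begin
    weigh f (p ++ q)             ≡⟨ weigh-++ f p q ⟩
    weigh f p + weigh f q        ≡⟨ cong₂ _+_ (weigh-≡ p≈p′ f) (weigh-≡ q≈q′ f) ⟩
    weigh f p′ + weigh f q′      ≡⟨ weigh-++ f p′ q′ ⟨
    weigh f (p′ ++ q′)           ∎
    where open ≡-Reasoning

  +P-assoc : ∀ p q s → (p +P q) +P s ≈ p +P (q +P s)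
  +P-assoc p q s = weigh-ext λ f → cong (weigh f) (ListP.++-assoc p q s)

  +P-comm : ∀ p q → p +P q ≈ q +P p
  +P-comm p q = weigh-ext λ f →
    trans (weigh-++ f p q) (trans (ℤP.+-comm (weigh f p) _) (sym (weigh-++ f q p)))

  +P-identityʳ : ∀ p → p +P zeroP ≈ p
  +P-identityʳ p = weigh-ext λ f → cong (weigh f) (ListP.++-identityʳ p)

  negP-cong : ∀ {p q} → p ≈ q → negP p ≈ negP q
  negP-cong {p} {q} p≈q = weigh-ext λ f →
    trans (weigh-negP f p) (trans (cong -_ (weigh-≡ p≈q f)) (sym (weigh-negP f q)))

  negP-inverseˡ : ∀ p → negP p +P p ≈ zeroP
  negP-inverseˡ p = weigh-ext λ f →
    trans (weigh-++ f (negP p) p)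
          (trans (cong (_+ weigh f p) (weigh-negP f p)) (ℤP.+-inverseˡ (weigh f p)))

  negP-inverseʳ : ∀ p → p +P negP p ≈ zeroP
  negP-inverseʳ p = weigh-ext λ f →
    trans (weigh-≡ (+P-comm p (negP p)) f) (weigh-≡ (negP-inverseˡ p) f)

  *P-cong : ∀ {p p′ q q′} → p ≈ p′ → q ≈ q′ → p *P q ≈ p′ *P q′
  *P-cong {p} {p′} {q} {q′} p≈p′ q≈q′ = weigh-ext λ f → begin
    weigh f (p *P q)                                     ≡⟨ weigh-*P f p q ⟩
    weigh (λ m → weigh (λ n → f (monMul m n)) q) p       ≡⟨ weigh-≡ p≈p′ _ ⟩
    weigh (λ m → weigh (λ n → f (monMul m n)) q) p′      ≡⟨ weigh-congˡ (λ m → weigh-≡ q≈q′ _) p′ ⟩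
    weigh (λ m → weigh (λ n → f (monMul m n)) q′) p′     ≡⟨ weigh-*P f p′ q′ ⟨
    weigh f (p′ *P q′)                                   ∎
    where open ≡-Reasoning

  *P-assoc : ∀ p q s → (p *P q) *P s ≈ p *P (q *P s)
  *P-assoc p q s = weigh-ext λ f → begin
    weigh f ((p *P q) *P s)
      ≡⟨ trans (weigh-*P f (p *P q) s) (weigh-*P _ p q) ⟩
    weigh (λ m → weigh (λ n → weigh (λ o → f (monMul (monMul m n) o)) s) q) p
      ≡⟨ weigh-congˡ (λ m → weigh-congˡ (λ n → weigh-congˡ (λ o → cong f (monMul-assoc m n o)) s) q) p ⟩
    weigh (λ m → weigh (λ n → weigh (λ o → f (monMul m (monMul n o))) s) q) p
      ≡⟨ trans (weigh-*P f p (q *P s)) (weigh-congˡ (λ m → weigh-*P _ q s) p) ⟨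
    weigh f (p *P (q *P s))
      ∎
    where open ≡-Reasoning

  *P-comm : ∀ p q → p *P q ≈ q *P p
  *P-comm p q = weigh-ext λ f → begin
    weigh f (p *P q)
      ≡⟨ weigh-*P f p q ⟩
    weigh (λ m → weigh (λ n → f (monMul m n)) q) p
      ≡⟨ weigh-comm (λ m n → f (monMul m n)) p q ⟩
    weigh (λ n → weigh (λ m → f (monMul m n)) p) q
      ≡⟨ weigh-congˡ (λ n → weigh-congˡ (λ m → cong f (monMul-comm m n)) p) q ⟩
    weigh (λ n → weigh (λ m → f (monMul n m)) p) q
      ≡⟨ weigh-*P f q p ⟨
    weigh f (q *P p)
      ∎
    where open ≡-Reasoning

  *P-identityˡ : ∀ p → oneP *P p ≈ p
  *P-identityˡ p = weigh-ext λ f → begin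
    weigh f (oneP *P p)                                ≡⟨ weigh-*P f oneP p ⟩
    + 1 * weigh (λ n → f (monMul mon1 n)) p + + 0      ≡⟨ trans (ℤP.+-identityʳ _) (ℤP.*-identityˡ _) ⟩
    weigh (λ n → f (monMul mon1 n)) p                  ≡⟨ weigh-congˡ (λ n → cong f (monMul-identityˡ n)) p ⟩
    weigh f p                                          ∎
    where open ≡-Reasoning

  *P-distribʳ : ∀ p q s → (q +P s) *P p ≈ (q *P p) +P (s *P p)
  *P-distribʳ p q s = weigh-ext λ f → begin
    weigh f ((q ++ s) *P p)                            ≡⟨ trans (weigh-*P f (q ++ s) p) (weigh-++ _ q s) ⟩
    weigh (g f) q + weigh (g f) s                      ≡⟨ cong₂ _+_ (weigh-*P f q p) (weigh-*P f s p) ⟨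
    weigh f (q *P p) + weigh f (s *P p)                ≡⟨ weigh-++ f (q *P p) (s *P p) ⟨
    weigh f ((q *P p) ++ (s *P p))                     ∎
    where
    open ≡-Reasoning
    g : (Mon r → ℤ) → Mon r → ℤ
    g f m = weigh (λ n → f (monMul m n)) p

polyRing : ℕ → CommutativeRing 0ℓ 0ℓ
polyRing r = record
  { Carrier = Defs.Poly r
  ; _≈_ = _≈_
  ; _+_ = _+P_
  ; _*_ = _*P_
  ; -_ = negP
  ; 0# = zeroP
  ; 1# = oneP
  ; isCommutativeRing = record
    { isRing = record
      { +-isAbelianGroup = record
        { isGroup = record
          { isMonoid = record
            { isSemigroup = record
              { isMagma = record { isEquivalence = ≈-isEquivalence ; ∙-cong = +P-cong }
              ; assoc = +P-assoc }
            ; identity = (λ p → weigh-ext λ f → refl) , +P-identityʳ }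
          ; inverse = negP-inverseˡ , negP-inverseʳ
          ; ⁻¹-cong = negP-cong }
        ; comm = +P-comm }
      ; *-cong = *P-cong
      ; *-assoc = *P-assoc
      ; *-identity = *P-identityˡ , λ p → ≈-trans (*P-comm p oneP) (*P-identityˡ p)
      ; distrib = (λ p q s → ≈-trans (*P-comm p (q +P s))
                               (≈-trans (*P-distribʳ p q s) (+P-cong (*P-comm q p) (*P-comm s p))))
                , *P-distribʳ }
    ; *-comm = *P-comm }
  }
  where
  open import Defs using (Poly; _+P_; _*P_; negP; zeroP; oneP)
  open PolynomialRing {r}
  open import Data.Product using (_,_)
  open import Relation.Binary.PropositionalEquality using (refl)
  open import Relation.Binary.Structures using (IsEquivalence)
  ≈-isEquivalence : IsEquivalence _≈_
  ≈-isEquivalence = record { refl = ≈-refl ; sym = ≈-sym ; trans = ≈-trans }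

module Determinant {c ℓ} (R : CommutativeRing c ℓ) where

  open CommutativeRing R
  open import Algebra.Properties.Ring ring
    using (-‿distribˡ-*; -‿distribʳ-*; -1*x≈-x; -‿involutive; ⁻¹-anti-homo‿-; -0#≈0#; +-inverseˡ-unique)
  open import Algebra.Properties.Semiring.Sum semiring
    using (sum; sum-syntax; sum-cong-≋; sum-replicate-zero; ∑-distrib-+; ∑-comm; *-distribˡ-sum; *-distribʳ-sum)
  open import Algebra.Properties.CommutativeSemigroup *-commutativeSemigroup using (x∙yz≈y∙xz)
  open import Algebra.Properties.CommutativeSemigroup +-commutativeSemigroup using (interchange)
  open import Data.Vec.Functional using (removeAt; tail; _∷_)
  open import Data.Sum using (_⊎_; inj₁; inj₂)
  open import Function using (_∘_)
  open import Level using (_⊔_)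
  open import Relation.Binary.PropositionalEquality as ≡ using (_≡_)
  open import Relation.Binary.Reasoning.Setoid setoid

  sign : ℕ → Carrier
  sign zero    = 1#
  sign (suc t) = - sign t

  det : ∀ n → (Fin n → Fin n → Carrier) → Carrier
  cofactor : ∀ {n} → (Fin n → Fin (suc n) → Carrier) → Fin (suc n) → Carrier
  expand : ∀ {n} → (Fin (suc n) → Carrier) → (Fin n → Fin (suc n) → Carrier) → Carrier

  det zero    a = 1#
  det (suc n) a = expand (a Fin.zero) (λ i → a (Fin.suc i))

  cofactor {n} M j = sign (toℕ j) * det n (λ i → removeAt (M i) j)

  expand {n} v M = ∑[ j < suc n ] (v j * cofactor M j)

  sign-*-cases : ∀ t x → (sign t * x ≈ x) ⊎ (sign t * x ≈ - x)
  sign-*-cases zero    x = inj₁ (*-identityˡ x)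
  sign-*-cases (suc t) x with sign-*-cases t x
  ... | inj₁ st*x≈x  = inj₂ (trans (sym (-‿distribˡ-* (sign t) x)) (-‿cong st*x≈x))
  ... | inj₂ st*x≈-x = inj₁ (trans (sym (-‿distribˡ-* (sign t) x)) (trans (-‿cong st*x≈-x) (-‿involutive x)))

  sum-zero : ∀ {n} {f : Fin n → Carrier} → (∀ j → f j ≈ 0#) → sum f ≈ 0#
  sum-zero {n} f≈0 = trans (sum-cong-≋ f≈0) (sum-replicate-zero n)

  sum-neg : ∀ {n} (f : Fin n → Carrier) → ∑[ j < n ] (- f j) ≈ - sum f
  sum-neg f = begin
    ∑[ j < _ ] (- f j)       ≈⟨ sum-cong-≋ (λ j → sym (-1*x≈-x (f j))) ⟩
    ∑[ j < _ ] (- 1# * f j)  ≈⟨ *-distribˡ-sum (- 1#) f ⟨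
    - 1# * sum f             ≈⟨ -1*x≈-x (sum f) ⟩
    - sum f                  ∎

  det-cong : ∀ n {a b : Fin n → Fin n → Carrier} → (∀ i j → a i j ≈ b i j) → det n a ≈ det n b
  det-cong zero    a≈b = refl
  det-cong (suc n) a≈b = sum-cong-≋ λ j →
    *-cong (a≈b Fin.zero j) (*-congˡ {sign (toℕ j)} (det-cong n λ i l → a≈b (Fin.suc i) (punchIn j l)))

  module _ {n} (M : Fin n → Fin (suc n) → Carrier) where

    expand-congˡ : ∀ {v w} → (∀ j → v j ≈ w j) → expand v M ≈ expand w M
    expand-congˡ v≈w = sum-cong-≋ λ j → *-congʳ {cofactor M j} (v≈w j)

    expand-+ : ∀ v w → expand (λ j → v j + w j) M ≈ expand v M + expand w M
    expand-+ v w = trans (sum-cong-≋ λ j → distribʳ (cofactor M j) (v j) (w j))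
                         (∑-distrib-+ (λ j → v j * cofactor M j) (λ j → w j * cofactor M j))

    expand-*ˡ : ∀ x v → expand (λ j → x * v j) M ≈ x * expand v M
    expand-*ˡ x v = trans (sum-cong-≋ λ j → *-assoc x (v j) (cofactor M j))
                          (sym (*-distribˡ-sum x (λ j → v j * cofactor M j)))

    expand-∑ : ∀ {p} (w : Fin p → Fin (suc n) → Carrier) →
               expand (λ j → ∑[ l < p ] w l j) M ≈ ∑[ l < p ] expand (w l) M
    expand-∑ w = begin
      ∑[ j < suc n ] (∑[ l < _ ] w l j * cofactor M j)
        ≈⟨ sum-cong-≋ (λ j → *-distribʳ-sum (cofactor M j) (λ l → w l j)) ⟩
      ∑[ j < suc n ] ∑[ l < _ ] (w l j * cofactor M j)
        ≈⟨ ∑-comm (λ j l → w l j * cofactor M j) ⟩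
      ∑[ l < _ ] ∑[ j < suc n ] (w l j * cofactor M j)
        ∎

  -- Without function extensionality, a function of a column selection has to be
  -- shown to respect pointwise equality of selections.
  Respects : ∀ {m p} → ((Fin m → Fin p) → Carrier) → Set ℓ
  Respects X = ∀ {γ γ′} → (∀ x → γ x ≡ γ′ x) → X γ ≈ X γ′

  record Alternating {p} (B : (Fin p → Carrier) → (Fin p → Carrier) → Carrier) : Set (c ⊔ ℓ) where
    field
      diagonal      : ∀ v → B v v ≈ 0#
      antisymmetric : ∀ v w → B v w + B w v ≈ 0#
  open Alternating

  alternating-zero : ∀ {p} → Alternating {p} (λ _ _ → 0#)
  alternating-zero = record { diagonal = λ _ → refl ; antisymmetric = λ _ _ → +-identityˡ 0# }

  alternating-difference : ∀ {p} (f : (Fin p → Carrier) → (Fin p → Carrier) → Carrier) →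
                           Alternating (λ v w → f v w - f w v)
  alternating-difference f = record
    { diagonal      = λ v → -‿inverseʳ (f v v)
    ; antisymmetric = λ v w → trans (+-congˡ (sym (⁻¹-anti-homo‿- (f v w) (f w v)))) (-‿inverseʳ _)
    }

  alternating-+ : ∀ {p A B} → Alternating {p} A → Alternating B → Alternating (λ v w → A v w + B v w)
  alternating-+ {A = A} {B} altA altB = record
    { diagonal      = λ v → trans (+-cong (diagonal altA v) (diagonal altB v)) (+-identityˡ 0#)
    ; antisymmetric = λ v w → begin
        (A v w + B v w) + (A w v + B w v)  ≈⟨ interchange (A v w) (B v w) (A w v) (B w v) ⟩
        (A v w + A w v) + (B v w + B w v)  ≈⟨ +-cong (antisymmetric altA v w) (antisymmetric altB v w) ⟩
        0# + 0#                            ≈⟨ +-identityˡ 0# ⟩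
        0#                                 ∎
    }

  alternating-cong : ∀ {p A B} → (∀ v w → A v w ≈ B v w) → Alternating {p} A → Alternating B
  alternating-cong A≈B altA = record
    { diagonal      = λ v → trans (sym (A≈B v v)) (diagonal altA v)
    ; antisymmetric = λ v w → trans (sym (+-cong (A≈B v w) (A≈B w v))) (antisymmetric altA v w)
    }

  alternating-∘ : ∀ {p q B} (f : (Fin q → Carrier) → (Fin p → Carrier)) →
                  Alternating B → Alternating (λ v w → B (f v) (f w))
  alternating-∘ f altB = record
    { diagonal      = λ v → diagonal altB (f v)
    ; antisymmetric = λ v w → antisymmetric altB (f v) (f w)
    }

  -- In the double expansion expand₂ X v w along rows v and w, X stands for the
  -- determinant of the remaining rows restricted to the columns left over.
  OnColumns : ℕ → Set c
  OnColumns m = (Fin m → Fin (suc (suc m))) → Carrier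

  expand₂ : ∀ {m} → OnColumns m → (v w : Fin (suc (suc m)) → Carrier) → Carrier
  expand₂ {m} X v w =
    ∑[ j < suc (suc m) ] (v j * (sign (toℕ j) *
      ∑[ j′ < suc m ] (w (punchIn j j′) * (sign (toℕ j′) * X (punchIn j ∘ punchIn j′)))))

  leading : ∀ {m} → OnColumns m → (v w : Fin (suc (suc m)) → Carrier) → Carrier
  leading {m} X v w = v Fin.zero * ∑[ u < suc m ] (w (Fin.suc u) * (sign (toℕ u) * X (Fin.suc ∘ punchIn u)))

  trailing : ∀ {m} → OnColumns m → (v w : Fin (suc (suc m)) → Carrier) → Carrier
  trailing {zero}  X v w = 0#
  trailing {suc m} X v w = expand₂ (X ∘ Fin.lift 1) (tail v) (tail w)

  respects-lift : ∀ {m p} {X : (Fin (suc m) → Fin (suc p)) → Carrier} → Respects X → Respects (X ∘ Fin.lift 1)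
  respects-lift resp γ≗γ′ = resp λ { Fin.zero → ≡.refl ; (Fin.suc x) → ≡.cong Fin.suc (γ≗γ′ x) }

  private
    -x*-y≈x*y : ∀ x y → - x * - y ≈ x * y
    -x*-y≈x*y x y = begin
      - x * - y      ≈⟨ -‿distribˡ-* x (- y) ⟨
      - (x * - y)    ≈⟨ -‿cong (-‿distribʳ-* x y) ⟨
      - - (x * y)    ≈⟨ -‿involutive (x * y) ⟩
      x * y          ∎

    x*[-s*y]≈-[x*[s*y]] : ∀ x s y → x * (- s * y) ≈ - (x * (s * y))
    x*[-s*y]≈-[x*[s*y]] x s y = trans (*-congˡ (sym (-‿distribˡ-* s y))) (sym (-‿distribʳ-* x (s * y)))

  private
    flippedInner : ∀ {m} → OnColumns m → (w : Fin (suc (suc m)) → Carrier) →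
                   Fin (suc m) → Carrier
    flippedInner {m} X w t =
      ∑[ u < m ] (w (Fin.suc (punchIn t u)) * (- sign (toℕ u) * X (punchIn (Fin.suc t) ∘ punchIn (Fin.suc u))))

  trailing-≈ : ∀ m {X : OnColumns m} → Respects X → ∀ v w →
               ∑[ t < suc m ] (v (Fin.suc t) * (- sign (toℕ t) * flippedInner X w t)) ≈ trailing X v w
  trailing-≈ zero {X} resp v w = sum-zero vanishes
    where
    vanishes : ∀ t → v (Fin.suc t) * (- sign (toℕ t) * flippedInner X w t) ≈ 0#
    vanishes t = trans (*-congˡ (zeroʳ (- sign (toℕ t)))) (zeroʳ (v (Fin.suc t)))
  trailing-≈ (suc m) {X} resp v w = sum-cong-≋ term
    where
    lifted : Fin (suc (suc m)) → Fin (suc m) → Carrier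
    lifted t u = sign (toℕ u) * X (Fin.lift 1 (punchIn t ∘ punchIn u))
    I′ : Fin (suc (suc m)) → Carrier
    I′ t = ∑[ u < suc m ] (w (Fin.suc (punchIn t u)) * lifted t u)
    flippedInner≈ : ∀ t → flippedInner X w t ≈ - I′ t
    flippedInner≈ t = trans (sum-cong-≋ summand) (sum-neg (λ u → w (Fin.suc (punchIn t u)) * lifted t u))
      where
      summand : ∀ u → w (Fin.suc (punchIn t u)) * (- sign (toℕ u) * X (punchIn (Fin.suc t) ∘ punchIn (Fin.suc u)))
                      ≈ - (w (Fin.suc (punchIn t u)) * lifted t u)
      summand u = trans (x*[-s*y]≈-[x*[s*y]] _ _ _)
                        (-‿cong (*-congˡ (*-congˡ (resp λ { Fin.zero → ≡.refl ; (Fin.suc x) → ≡.refl }))))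
    term : ∀ t → v (Fin.suc t) * (- sign (toℕ t) * flippedInner X w t) ≈ v (Fin.suc t) * (sign (toℕ t) * I′ t)
    term t = *-congˡ (trans (*-congˡ (flippedInner≈ t)) (-x*-y≈x*y (sign (toℕ t)) (I′ t)))

  -- Expanding along v and then w, the terms in which v or w uses the first
  -- column are the two leading sums; the others form the same double expansion
  -- on the remaining columns, with both signs flipped.
  expand₂-split : ∀ {m} {X : OnColumns m} → Respects X → ∀ v w →
                  expand₂ X v w ≈ (leading X v w - leading X w v) + trailing X v w
  expand₂-split {m} {X} resp v w = begin
    expand₂ X v w
      ≡⟨⟩
    v Fin.zero * (1# * S) + ∑[ t < suc m ] (v (Fin.suc t) * (- sign (toℕ t) * (w Fin.zero * (1# * Y t) + I t)))
      ≈⟨ +-cong (*-congˡ (*-identityˡ S)) (sum-cong-≋ term) ⟩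
    leading X v w + ∑[ t < suc m ] (- (w Fin.zero * L t) + v (Fin.suc t) * (- sign (toℕ t) * I t))
      ≈⟨ +-congˡ (∑-distrib-+ (λ t → - (w Fin.zero * L t)) (λ t → v (Fin.suc t) * (- sign (toℕ t) * I t))) ⟩
    leading X v w + (∑[ t < suc m ] (- (w Fin.zero * L t))
                     + ∑[ t < suc m ] (v (Fin.suc t) * (- sign (toℕ t) * I t)))
      ≈⟨ +-congˡ (+-cong (trans (sum-neg (λ t → w Fin.zero * L t)) (-‿cong (sym (*-distribˡ-sum (w Fin.zero) L))))
                         (trailing-≈ m resp v w)) ⟩
    leading X v w + (- leading X w v + trailing X v w)
      ≈⟨ +-assoc _ _ _ ⟨
    (leading X v w - leading X w v) + trailing X v w
      ∎
    where
    S : Carrier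
    S = ∑[ u < suc m ] (w (Fin.suc u) * (sign (toℕ u) * X (Fin.suc ∘ punchIn u)))
    Y : Fin (suc m) → Carrier
    Y t = X (Fin.suc ∘ punchIn t)
    L : Fin (suc m) → Carrier
    L t = v (Fin.suc t) * (sign (toℕ t) * Y t)
    I : Fin (suc m) → Carrier
    I = flippedInner X w
    term : ∀ t → v (Fin.suc t) * (- sign (toℕ t) * (w Fin.zero * (1# * Y t) + I t))
               ≈ - (w Fin.zero * L t) + v (Fin.suc t) * (- sign (toℕ t) * I t)
    term t = begin
      a * (- s * (b * (1# * Y t) + I t))          ≈⟨ *-congˡ (*-congˡ (+-congʳ (*-congˡ (*-identityˡ (Y t))))) ⟩
      a * (- s * (b * Y t + I t))                 ≈⟨ *-congˡ (distribˡ (- s) (b * Y t) (I t)) ⟩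
      a * (- s * (b * Y t) + - s * I t)           ≈⟨ distribˡ a (- s * (b * Y t)) (- s * I t) ⟩
      a * (- s * (b * Y t)) + a * (- s * I t)     ≈⟨ +-congʳ (x*[-s*y]≈-[x*[s*y]] a s (b * Y t)) ⟩
      - (a * (s * (b * Y t))) + a * (- s * I t)   ≈⟨ +-congʳ (-‿cong (*-congˡ (x∙yz≈y∙xz s b (Y t)))) ⟩
      - (a * (b * (s * Y t))) + a * (- s * I t)   ≈⟨ +-congʳ (-‿cong (x∙yz≈y∙xz a b (s * Y t))) ⟩
      - (b * L t) + a * (- s * I t)               ∎
      where
      a = v (Fin.suc t)
      b = w Fin.zero
      s = sign (toℕ t)

  expand₂-alternating : ∀ m {X : OnColumns m} → Respects X → Alternating (expand₂ X)
  expand₂-alternating m {X} resp =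
    alternating-cong (λ v w → sym (expand₂-split resp v w))
      (alternating-+ (alternating-difference (leading X)) (trailing-alternating m resp))
    where
    trailing-alternating : ∀ m {X : OnColumns m} → Respects X → Alternating (trailing X)
    trailing-alternating zero    resp = alternating-zero
    trailing-alternating (suc m) resp = alternating-∘ tail (expand₂-alternating m (respects-lift resp))

  det-respects : ∀ m {p} (M : Fin m → Fin p → Carrier) → Respects (λ γ → det m (λ i → M i ∘ γ))
  det-respects m M γ≗γ′ = det-cong m λ i l → reflexive (≡.cong (M i) (γ≗γ′ l))

  expand-repeatedRow : ∀ {n} (M : Fin n → Fin (suc n) → Carrier) i → expand (M i) M ≈ 0#
  expand-repeatedRow {suc m} M Fin.zero =
    diagonal (expand₂-alternating m (det-respects m (M ∘ Fin.suc))) (M Fin.zero)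
  expand-repeatedRow {suc m} M (Fin.suc i) = begin
    expand (M (Fin.suc i)) M
      ≡⟨⟩
    expand₂ X (M (Fin.suc i)) (M Fin.zero)
      ≈⟨ +-inverseˡ-unique _ _ (antisymmetric alternating (M (Fin.suc i)) (M Fin.zero)) ⟩
    - expand₂ X (M Fin.zero) (M (Fin.suc i))
      ≡⟨⟩
    - expand (M Fin.zero) (M (Fin.suc i) ∷ tail M)
      ≈⟨ -‿cong (sum-zero vanishes) ⟩
    - 0#
      ≈⟨ -0#≈0# ⟩
    0#
      ∎
    where
    X : OnColumns m
    X γ = det m (λ i → M (Fin.suc i) ∘ γ)
    alternating : Alternating (expand₂ X)
    alternating = expand₂-alternating m (det-respects m (M ∘ Fin.suc))
    vanishes : ∀ j → M Fin.zero j * cofactor (M (Fin.suc i) ∷ tail M) j ≈ 0#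
    vanishes j = trans (*-congˡ (trans (*-congˡ (expand-repeatedRow (λ l → removeAt (M (Fin.suc l)) j) i))
                                       (zeroʳ (sign (toℕ j)))))
                       (zeroʳ (M Fin.zero j))

  expand-addRows : ∀ {n} (M : Fin n → Fin (suc n) → Carrier) (x : Fin n → Carrier) v →
                   expand (λ j → v j + ∑[ l < n ] (x l * M l j)) M ≈ expand v M
  expand-addRows {n} M x v = begin
    expand (λ j → v j + ∑[ l < n ] (x l * M l j)) M
      ≈⟨ expand-+ M v (λ j → ∑[ l < n ] (x l * M l j)) ⟩
    expand v M + expand (λ j → ∑[ l < n ] (x l * M l j)) M
      ≈⟨ +-congˡ (expand-∑ M (λ l j → x l * M l j)) ⟩
    expand v M + ∑[ l < n ] expand (λ j → x l * M l j) M
      ≈⟨ +-congˡ (sum-zero vanishes) ⟩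
    expand v M + 0#
      ≈⟨ +-identityʳ _ ⟩
    expand v M
      ∎
    where
    vanishes : ∀ l → expand (λ j → x l * M l j) M ≈ 0#
    vanishes l = trans (expand-*ˡ M (x l) (M l)) (trans (*-congˡ (expand-repeatedRow M l)) (zeroʳ (x l)))

module Coefficients {r : ℕ} where

  open import Defs hiding (det)
  open PolynomialRing {r}
  open import Data.Nat using (s≤s)
  import Data.Nat.Properties as ℕP
  open import Data.Integer using (ℤ; +_; -_; _+_; _*_)
  import Data.Integer.Properties as ℤP
  open import Data.List using ([]; _∷_; _++_; length; filter)
  import Data.List.Properties as ListP
  open import Data.List.Relation.Unary.All as All using (All; []; _∷_)
  import Data.List.Relation.Unary.All.Properties as AllP
  open import Data.Product using (_,_; proj₂)
  open import Data.Empty using (⊥-elim)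
  open import Data.Unit using (tt)
  open import Function using (_∘_)
  open import Relation.Nullary using (Dec; yes; no; ¬_)
  open import Relation.Unary using (Pred; Decidable)
  open import Relation.Unary.Properties using (∁?)
  open import Relation.Binary.PropositionalEquality

  indicator : Mon r → Mon r → ℤ
  indicator m m′ with mon-dec m′ m
  ... | yes _ = + 1
  ... | no _  = + 0

  coeff-weigh : ∀ (p : Poly r) m → coeff p m ≡ weigh (indicator m) p
  coeff-weigh []             m = refl
  coeff-weigh ((c , m′) ∷ p) m with mon-dec m′ m
  ... | yes _ = cong₂ _+_ (sym (ℤP.*-identityʳ c)) (coeff-weigh p m)
  ... | no _  = trans (coeff-weigh p m)
                      (sym (trans (cong (_+ weigh (indicator m) p) (ℤP.*-zeroʳ c)) (ℤP.+-identityˡ _)))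

  coeff-∷-≡ : ∀ c m (p : Poly r) → coeff ((c , m) ∷ p) m ≡ c + coeff p m
  coeff-∷-≡ c m p with mon-dec m m
  ... | yes _    = refl
  ... | no m≢m   = ⊥-elim (m≢m refl)

  coeff-∷-≢ : ∀ c {m′ m} (p : Poly r) → m′ ≢ m → coeff ((c , m′) ∷ p) m ≡ coeff p m
  coeff-∷-≢ c {m′} {m} p m′≢m with mon-dec m′ m
  ... | yes m′≡m = ⊥-elim (m′≢m m′≡m)
  ... | no _     = refl

  coeff-cong : ∀ {p q : Poly r} → p ≈ q → ∀ m → coeff p m ≡ coeff q m
  coeff-cong {p} {q} p≈q m =
    trans (coeff-weigh p m) (trans (weigh-≡ p≈q (indicator m)) (sym (coeff-weigh q m)))

  coeff-++ : ∀ (p q : Poly r) m → coeff (p ++ q) m ≡ coeff p m + coeff q m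
  coeff-++ p q m = begin
    coeff (p ++ q) m                                        ≡⟨ coeff-weigh (p ++ q) m ⟩
    weigh (indicator m) (p ++ q)                            ≡⟨ weigh-++ (indicator m) p q ⟩
    weigh (indicator m) p + weigh (indicator m) q           ≡⟨ cong₂ _+_ (coeff-weigh p m) (coeff-weigh q m) ⟨
    coeff p m + coeff q m                                   ∎
    where open ≡-Reasoning

  coeff-negP : ∀ (p : Poly r) m → coeff (negP p) m ≡ - coeff p m
  coeff-negP p m =
    trans (coeff-weigh (negP p) m) (trans (weigh-negP (indicator m) p) (cong -_ (sym (coeff-weigh p m))))

  SupportedIn : Pred (Mon r) 0ℓ → Poly r → Set
  SupportedIn G = All (G ∘ proj₂)

  restrict : ∀ {G : Pred (Mon r) 0ℓ} → Decidable G → Poly r → Poly r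
  restrict G? = filter (G? ∘ proj₂)

  restrict-supported : ∀ {G : Pred (Mon r) 0ℓ} (G? : Decidable G) p → SupportedIn G (restrict G? p)
  restrict-supported G? = AllP.all-filter (G? ∘ proj₂)

  weigh-restrict : ∀ {G : Pred (Mon r) 0ℓ} (G? : Decidable G) f (p : Poly r) →
                   weigh f p ≡ weigh f (restrict G? p) + weigh f (restrict (∁? G?) p)
  weigh-restrict G? f []            = refl
  weigh-restrict G? f ((c , m) ∷ p) with G? m
  ... | yes _ = trans (cong (_+_ (c * f m)) (weigh-restrict G? f p)) (sym (ℤP.+-assoc (c * f m) _ _))
  ... | no _  = begin
    c * f m + weigh f p                 ≡⟨ cong (_+_ (c * f m)) (weigh-restrict G? f p) ⟩
    c * f m + (x + y)                   ≡⟨ sym (ℤP.+-assoc (c * f m) x y) ⟩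
    (c * f m + x) + y                   ≡⟨ cong (_+ y) (ℤP.+-comm (c * f m) x) ⟩
    (x + c * f m) + y                   ≡⟨ ℤP.+-assoc x (c * f m) y ⟩
    x + (c * f m + y)                   ∎
    where
    open ≡-Reasoning
    x = weigh f (restrict G? p)
    y = weigh f (restrict (∁? G?) p)

  coeff-restrict : ∀ {G : Pred (Mon r) 0ℓ} (G? : Decidable G) (p : Poly r) m →
                   coeff p m ≡ coeff (restrict G? p) m + coeff (restrict (∁? G?) p) m
  coeff-restrict G? p m = begin
    coeff p m                                        ≡⟨ coeff-weigh p m ⟩
    weigh (indicator m) p                            ≡⟨ weigh-restrict G? (indicator m) p ⟩
    weigh (indicator m) (restrict G? p) + weigh (indicator m) (restrict (∁? G?) p)
      ≡⟨ cong₂ _+_ (coeff-weigh (restrict G? p) m) (coeff-weigh (restrict (∁? G?) p) m) ⟨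
    coeff (restrict G? p) m + coeff (restrict (∁? G?) p) m ∎
    where open ≡-Reasoning

  record VanishesOutside (G : Pred (Mon r) 0ℓ) (p : Poly r) : Set where
    constructor vanishing
    field coeff-outside : ∀ m → ¬ G m → coeff p m ≡ + 0
  open VanishesOutside public

  supported⇒coeff-outside : ∀ {G} {p : Poly r} → SupportedIn G p → ∀ m → ¬ G m → coeff p m ≡ + 0
  supported⇒coeff-outside {p = []}            []        m ¬Gm = refl
  supported⇒coeff-outside {p = (c , m′) ∷ p} (Gm′ ∷ s) m ¬Gm with mon-dec m′ m
  ... | yes refl = ⊥-elim (¬Gm Gm′)
  ... | no _     = supported⇒coeff-outside s m ¬Gm

  supported⇒vanishesOutside : ∀ {G} {p : Poly r} → SupportedIn G p → VanishesOutside G p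
  supported⇒vanishesOutside s = vanishing (supported⇒coeff-outside s)

  vanishesOutside-cong : ∀ {G} {p q : Poly r} → p ≈ q → VanishesOutside G p → VanishesOutside G q
  vanishesOutside-cong p≈q vp = vanishing λ m ¬Gm → trans (sym (coeff-cong p≈q m)) (coeff-outside vp m ¬Gm)

  vanishesOutside-mono : ∀ {G H} {p : Poly r} → (∀ m → G m → H m) → VanishesOutside G p → VanishesOutside H p
  vanishesOutside-mono G⊆H vp = vanishing λ m ¬Hm → coeff-outside vp m (¬Hm ∘ G⊆H m)

  vanishesOutside-++ : ∀ {G} {p q : Poly r} →
                       VanishesOutside G p → VanishesOutside G q → VanishesOutside G (p ++ q)
  vanishesOutside-++ {p = p} {q} vp vq = vanishing λ m ¬Gm →
    trans (coeff-++ p q m) (cong₂ _+_ (coeff-outside vp m ¬Gm) (coeff-outside vq m ¬Gm))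

  vanishesOutside-negP : ∀ {G} {p : Poly r} → VanishesOutside G p → VanishesOutside G (negP p)
  vanishesOutside-negP {p = p} vp = vanishing λ m ¬Gm → trans (coeff-negP p m) (cong -_ (coeff-outside vp m ¬Gm))

  private
    weigh-constant : ∀ f m₀ (p : Poly r) → SupportedIn (_≡ m₀) p → weigh f p ≡ coeff p m₀ * f m₀
    weigh-constant f m₀ []            []          = refl
    weigh-constant f m₀ ((c , m) ∷ p) (refl ∷ s) = begin
      c * f m + weigh f p               ≡⟨ cong (_+_ (c * f m)) (weigh-constant f m p s) ⟩
      c * f m + coeff p m * f m         ≡⟨ ℤP.*-distribʳ-+ (f m) c (coeff p m) ⟨
      (c + coeff p m) * f m             ≡⟨ cong (_* f m) (coeff-∷-≡ c m p) ⟨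
      coeff ((c , m) ∷ p) m * f m       ∎
      where open ≡-Reasoning

    -- By induction on the length: the terms carrying the monomial m₀ of the head
    -- contribute coeff p m₀ * f m₀ = 0, and the others form a shorter list.
    coeffs-zero⇒weigh-zero : ∀ n (p : Poly r) → length p ≤ n → (∀ m → coeff p m ≡ + 0) → ∀ f → weigh f p ≡ + 0
    coeffs-zero⇒weigh-zero n       []              _          _      f = refl
    coeffs-zero⇒weigh-zero (suc n) ((c , m₀) ∷ p) (s≤s |p|≤n) coeffs0 f = begin
      c * f m₀ + weigh f p
        ≡⟨ cong (_+_ (c * f m₀)) (weigh-restrict (_≟ₘ m₀) f p) ⟩
      c * f m₀ + (weigh f same + weigh f rest)
        ≡⟨ cong (λ x → c * f m₀ + (x + weigh f rest)) (weigh-constant f m₀ same (restrict-supported _ p)) ⟩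
      c * f m₀ + (coeff same m₀ * f m₀ + weigh f rest)
        ≡⟨ sym (ℤP.+-assoc (c * f m₀) _ _) ⟩
      (c * f m₀ + coeff same m₀ * f m₀) + weigh f rest
        ≡⟨ cong (_+ weigh f rest) (sym (ℤP.*-distribʳ-+ (f m₀) c (coeff same m₀))) ⟩
      (c + coeff same m₀) * f m₀ + weigh f rest
        ≡⟨ cong₂ (λ x y → x * f m₀ + y) c+same≡0 (coeffs-zero⇒weigh-zero n rest |rest|≤n rest-coeffs0 f) ⟩
      + 0
        ∎
      where
      open ≡-Reasoning
      _≟ₘ_ : (m m′ : Mon r) → Dec (m ≡ m′)
      _≟ₘ_ = mon-dec
      same rest : Poly r
      same = restrict (_≟ₘ m₀) p
      rest = restrict (∁? (_≟ₘ m₀)) p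
      |rest|≤n : length rest ≤ n
      |rest|≤n = ℕP.≤-trans (ListP.length-filter _ p) |p|≤n
      same-outside : ∀ m → m ≢ m₀ → coeff same m ≡ + 0
      same-outside = supported⇒coeff-outside (restrict-supported _ p)
      rest-m₀ : coeff rest m₀ ≡ + 0
      rest-m₀ = supported⇒coeff-outside (restrict-supported _ p) m₀ (λ m₀≢m₀ → m₀≢m₀ refl)
      split : ∀ m → coeff p m ≡ coeff same m + coeff rest m
      split = coeff-restrict (_≟ₘ m₀) p
      c+same≡0 : c + coeff same m₀ ≡ + 0
      c+same≡0 = begin
        c + coeff same m₀                      ≡⟨ cong (_+_ c) (sym (ℤP.+-identityʳ _)) ⟩
        c + (coeff same m₀ + + 0)              ≡⟨ cong (λ x → c + (coeff same m₀ + x)) (sym rest-m₀) ⟩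
        c + (coeff same m₀ + coeff rest m₀)    ≡⟨ cong (_+_ c) (sym (split m₀)) ⟩
        c + coeff p m₀                         ≡⟨ sym (coeff-∷-≡ c m₀ p) ⟩
        coeff ((c , m₀) ∷ p) m₀                ≡⟨ coeffs0 m₀ ⟩
        + 0                                    ∎
      rest-coeffs0 : ∀ m → coeff rest m ≡ + 0
      rest-coeffs0 m with mon-dec m m₀
      ... | yes refl = rest-m₀
      ... | no m≢m₀  = begin
        coeff rest m                           ≡⟨ sym (ℤP.+-identityˡ _) ⟩
        + 0 + coeff rest m                     ≡⟨ cong (_+ coeff rest m) (sym (same-outside m m≢m₀)) ⟩
        coeff same m + coeff rest m            ≡⟨ sym (split m) ⟩
        coeff p m                              ≡⟨ sym (coeff-∷-≢ c p (m≢m₀ ∘ sym)) ⟩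
        coeff ((c , m₀) ∷ p) m                 ≡⟨ coeffs0 m ⟩
        + 0                                    ∎

  coeffs-zero⇒≈zeroP : ∀ (p : Poly r) → (∀ m → coeff p m ≡ + 0) → p ≈ zeroP
  coeffs-zero⇒≈zeroP p coeffs0 = weigh-ext (coeffs-zero⇒weigh-zero (length p) p ℕP.≤-refl coeffs0)

  vanishesOutside⇒≈restrict : ∀ {G} (G? : Decidable G) {p : Poly r} → VanishesOutside G p → p ≈ restrict G? p
  vanishesOutside⇒≈restrict {G} G? {p} vanishes = weigh-ext λ f → begin
    weigh f p                                           ≡⟨ weigh-restrict G? f p ⟩
    weigh f (restrict G? p) + weigh f outside
      ≡⟨ cong (_+_ (weigh f (restrict G? p))) (weigh-≡ (coeffs-zero⇒≈zeroP outside outside-coeffs0) f) ⟩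
    weigh f (restrict G? p) + + 0                       ≡⟨ ℤP.+-identityʳ _ ⟩
    weigh f (restrict G? p)                             ∎
    where
    open ≡-Reasoning
    outside : Poly r
    outside = restrict (∁? G?) p
    inside-coeff0 : ∀ m → ¬ G m → coeff (restrict G? p) m ≡ + 0
    inside-coeff0 = supported⇒coeff-outside (restrict-supported G? p)
    outside-coeffs0 : ∀ m → coeff outside m ≡ + 0
    outside-coeffs0 m with G? m
    ... | yes Gm  = supported⇒coeff-outside (restrict-supported _ p) m (λ ¬Gm → ¬Gm Gm)
    ... | no ¬Gm  = begin
      coeff outside m                                 ≡⟨ sym (ℤP.+-identityˡ _) ⟩
      + 0 + coeff outside m                           ≡⟨ cong (_+ coeff outside m) (sym (inside-coeff0 m ¬Gm)) ⟩
      coeff (restrict G? p) m + coeff outside m       ≡⟨ sym (coeff-restrict G? p m) ⟩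
      coeff p m                                       ≡⟨ coeff-outside vanishes m ¬Gm ⟩
      + 0                                             ∎

  supported-*P : ∀ {G H K} → (∀ m n → G m → H n → K (monMul m n)) →
                 ∀ {p q : Poly r} → SupportedIn G p → SupportedIn H q → SupportedIn K (p *P q)
  supported-*P closed {[]}           []        sq = []
  supported-*P closed {(c , m) ∷ p} (Gm ∷ sp) sq =
    AllP.++⁺ (AllP.map⁺ (All.map (λ {t} → closed m (proj₂ t) Gm) sq)) (supported-*P closed sp sq)

  vanishesOutside-*P : ∀ {G H K} (G? : Decidable G) (H? : Decidable H) →
                       (∀ m n → G m → H n → K (monMul m n)) → ∀ {p q : Poly r} → VanishesOutside G p → VanishesOutside H q → VanishesOutside K (p *P q)
  vanishesOutside-*P G? H? closed {p} {q} vp vq =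
    vanishesOutside-cong
      (*P-cong (≈-sym (vanishesOutside⇒≈restrict G? vp)) (≈-sym (vanishesOutside⇒≈restrict H? vq)))
      (supported⇒vanishesOutside (supported-*P closed (restrict-supported G? p) (restrict-supported H? q)))

  vanishesOutside-*P-ideal : ∀ {G} (G? : Decidable G) → (∀ m n → G m → G (monMul m n)) →
                             ∀ {p} q → VanishesOutside G p → VanishesOutside G (p *P q)
  vanishesOutside-*P-ideal G? G-upward q vp =
    vanishesOutside-*P G? (λ _ → yes tt) (λ m n Gm _ → G-upward m n Gm) vp (vanishing λ _ ¬⊤ → ⊥-elim (¬⊤ tt))

  coeff-monomial-*P : ∀ a (q : Poly r) m → coeff (((+ 1 , a) ∷ []) *P q) (monMul a m) ≡ coeff q m
  coeff-monomial-*P a q m = begin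
    coeff (((+ 1 , a) ∷ []) *P q) (monMul a m)
      ≡⟨ coeff-weigh (((+ 1 , a) ∷ []) *P q) (monMul a m) ⟩
    weigh (indicator (monMul a m)) (((+ 1 , a) ∷ []) *P q)
      ≡⟨ weigh-*P _ ((+ 1 , a) ∷ []) q ⟩
    + 1 * weigh (λ n → indicator (monMul a m) (monMul a n)) q + + 0
      ≡⟨ trans (ℤP.+-identityʳ _) (ℤP.*-identityˡ _) ⟩
    weigh (λ n → indicator (monMul a m) (monMul a n)) q
      ≡⟨ weigh-congˡ indicator-monMul q ⟩
    weigh (indicator m) q
      ≡⟨ coeff-weigh q m ⟨
    coeff q m
      ∎
    where
    open ≡-Reasoning
    indicator-monMul : ∀ n → indicator (monMul a m) (monMul a n) ≡ indicator m n
    indicator-monMul n with mon-dec (monMul a n) (monMul a m) | mon-dec n m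
    ... | yes _     | yes _   = refl
    ... | no _      | no _    = refl
    ... | yes an≡am | no n≢m  = ⊥-elim (n≢m (monMul-cancelˡ a n m an≡am))
    ... | no an≢am  | yes n≡m = ⊥-elim (an≢am (cong (monMul a) n≡m))

module SumsOverInjections {c ℓ} (M : CommutativeMonoid c ℓ) where

  open CommutativeMonoid M renaming (_∙_ to _+_; ε to 0#)
  open import Algebra.Properties.CommutativeMonoid.Sum M
    using (sum; sum-syntax; sum-cong-≋; sum-replicate-zero; sum-remove)
  open import Data.Fin.Properties using (punchInᵢ≢i)
  open import Data.Vec.Functional using (removeAt)
  open import Function using (_∘_)
  open import Function.Definitions using (Injective)
  open import Relation.Binary.PropositionalEquality as ≡ using (_≡_; _≢_)
  open import Relation.Binary.Reasoning.Setoid setoid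

  ∑-∘-missed : ∀ {n k} (ρ : Fin n → Fin k) {t} (ψ : Fin k → Carrier) → (∀ t′ → t′ ≢ t → ψ t′ ≈ 0#) →
               (∀ l → ρ l ≢ t) → ∑[ l < n ] ψ (ρ l) ≈ 0#
  ∑-∘-missed {n} ρ ψ ψ-single missed = trans (sum-cong-≋ (λ l → ψ-single (ρ l) (missed l))) (sum-replicate-zero n)

  ∑-∘-hit : ∀ {n k} (ρ : Fin (suc n) → Fin k) {t} (ψ : Fin k → Carrier) → (∀ t′ → t′ ≢ t → ψ t′ ≈ 0#) →
            Injective _≡_ _≡_ ρ → ∀ l → ρ l ≡ t → ∑[ l < suc n ] ψ (ρ l) ≈ ψ t
  ∑-∘-hit {n} ρ {t} ψ ψ-single ρ-injective l ρl≡t = begin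
    ∑[ l < suc n ] ψ (ρ l)                  ≈⟨ sum-remove {i = l} (ψ ∘ ρ) ⟩
    ψ (ρ l) + sum (removeAt (ψ ∘ ρ) l)      ≈⟨ ∙-cong (reflexive (≡.cong ψ ρl≡t))
                                                      (∑-∘-missed (ρ ∘ punchIn l) ψ ψ-single others-missed) ⟩
    ψ t + 0#                                ≈⟨ identityʳ (ψ t) ⟩
    ψ t                                     ∎
    where
    others-missed : ∀ x → ρ (punchIn l x) ≢ t
    others-missed x ρx≡t = punchInᵢ≢i l x (ρ-injective (≡.trans ρx≡t (≡.sym ρl≡t)))

module PolynomialDeterminants {r : ℕ} where

  open import Defs using (Mon; Poly; monMul; mon1; _*P_; sumP; signP)
  import Defs
  open PolynomialRing {r}
  open Coefficients {r}
  open Determinant (polyRing r) public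
    using (sign; det; cofactor; expand; expand-congˡ; expand-+; expand-*ˡ; expand-addRows)
  open Determinant (polyRing r) using (sign-*-cases)
  private module R = CommutativeRing (polyRing r)
  open import Algebra.Properties.Semiring.Sum R.semiring public using (sum; sum-syntax)
  open import Algebra.Properties.Ring R.ring using (-1*x≈-x; -‿involutive)
  open import Algebra.Properties.CommutativeSemigroup R.*-commutativeSemigroup using (x∙yz≈y∙xz)
  open import Data.List.Relation.Unary.All using ([]; _∷_)
  import Data.List.Relation.Unary.All.Properties as AllP
  open import Data.Sum using (inj₁; inj₂)
  open import Function using (_∘_)
  open import Relation.Binary.PropositionalEquality using (refl)

  vanishesOutside-sum : ∀ {G n} (f : Fin n → Poly r) → (∀ j → VanishesOutside G (f j)) → VanishesOutside G (sum f)
  vanishesOutside-sum {n = zero}  f vanishes = vanishing λ _ _ → refl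
  vanishesOutside-sum {n = suc n} f vanishes =
    vanishesOutside-++ (vanishes Fin.zero) (vanishesOutside-sum (f ∘ Fin.suc) (vanishes ∘ Fin.suc))

  vanishesOutside-sign : ∀ {G} t {p} → VanishesOutside G p → VanishesOutside G (sign t *P p)
  vanishesOutside-sign t {p} vp with sign-*-cases t p
  ... | inj₁ sp≈p  = vanishesOutside-cong (≈-sym sp≈p) vp
  ... | inj₂ sp≈-p = vanishesOutside-cong (≈-sym sp≈-p) (vanishesOutside-negP vp)

  supported-sum : ∀ {G n} (f : Fin n → Poly r) → (∀ j → SupportedIn G (f j)) → SupportedIn G (sum f)
  supported-sum {n = zero}  f supported = []
  supported-sum {n = suc n} f supported =
    AllP.++⁺ (supported Fin.zero) (supported-sum (f ∘ Fin.suc) (supported ∘ Fin.suc))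

  module _ {G : Mon r → Set} (G-closed : ∀ m n → G m → G n → G (monMul m n)) (G-one : G mon1) where

    supported-sign : ∀ t → SupportedIn G (sign t)
    supported-sign zero    = G-one ∷ []
    supported-sign (suc t) = AllP.map⁺ (supported-sign t)

    supported-det : ∀ n {a : Fin n → Fin n → Poly r} → (∀ i j → SupportedIn G (a i j)) → SupportedIn G (det n a)
    supported-expand : ∀ {n} {v : Fin (suc n) → Poly r} {M : Fin n → Fin (suc n) → Poly r} →
                       (∀ j → SupportedIn G (v j)) → (∀ i j → SupportedIn G (M i j)) → SupportedIn G (expand v M)

    supported-det zero    supported = G-one ∷ []
    supported-det (suc n) supported = supported-expand (supported Fin.zero) (supported ∘ Fin.suc)

    supported-expand {n} supported-v supported-M = supported-sum _ λ j →
      supported-*P G-closed (supported-v j)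
        (supported-*P G-closed (supported-sign (toℕ j)) (supported-det n λ i l → supported-M i (punchIn j l)))

  Defs-det≈det : ∀ n (a : Fin n → Fin n → Poly r) → Defs.det n a ≈ det n a
  Defs-det≈det zero    a = ≈-refl
  Defs-det≈det (suc n) a = sumP≈sum λ j → begin
    signP (toℕ j) (a Fin.zero j *P Defs.det n (minor j))    ≈⟨ signP≈sign-* (toℕ j) _ ⟩
    sign (toℕ j) *P (a Fin.zero j *P Defs.det n (minor j))  ≈⟨ x∙yz≈y∙xz (sign (toℕ j)) (a Fin.zero j) _ ⟩
    a Fin.zero j *P (sign (toℕ j) *P Defs.det n (minor j))
      ≈⟨ R.*-congˡ {a Fin.zero j} (R.*-congˡ {sign (toℕ j)} (Defs-det≈det n (minor j))) ⟩
    a Fin.zero j *P (sign (toℕ j) *P det n (minor j))       ∎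
    where
    open import Relation.Binary.Reasoning.Setoid R.setoid
    minor : Fin (suc n) → Fin n → Fin n → Poly r
    minor j i l = a (Fin.suc i) (punchIn j l)
    sumP≈sum : ∀ {n} {f g : Fin n → Poly r} → (∀ j → f j ≈ g j) → sumP f ≈ sum g
    sumP≈sum {zero}  f≈g = ≈-refl
    sumP≈sum {suc n} f≈g = +P-cong (f≈g Fin.zero) (sumP≈sum (f≈g ∘ Fin.suc))
    signP≈sign-* : ∀ t p → signP t p ≈ sign t *P p
    signP≈sign-* zero          p = ≈-sym (*P-identityˡ p)
    signP≈sign-* (suc zero)    p = R.sym (-1*x≈-x p)
    signP≈sign-* (suc (suc t)) p = R.trans (signP≈sign-* t p) (R.*-congʳ (R.sym (-‿involutive (sign t))))

module Minors {r k : ℕ} (k≤r : k ≤ r) where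

  open import Defs hiding (det)
  open PolynomialRing {r}
  open Coefficients {r}
  open PolynomialDeterminants {r}
  private module R = CommutativeRing (polyRing r)
  open import Algebra.Properties.Semiring.Sum R.semiring using (sum-cong-≋; ∑-distrib-+)
  open import Algebra.Properties.Ring R.ring using (-‿distribʳ-*)
  open SumsOverInjections R.+-commutativeMonoid using (∑-∘-hit; ∑-∘-missed)
  open import Data.Nat as ℕ using (_≤?_)
  import Data.Nat.Properties as ℕP
  open import Data.Fin.Properties
    using (_≟_; any?; all?; inject≤-injective; 0≢1+n; suc-injective; <⇒≢; toℕ-injective; toℕ-inject≤;
           toℕ-fromℕ<; toℕ<n)
  open import Data.Vec using (Vec; lookup; replicate; zipWith)
  import Data.Vec.Properties as VecP
  open import Data.Integer using (+_)
  open import Data.Product using (Σ; ∃; _×_; _,_; proj₁; proj₂)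
  open import Data.Sum using (_⊎_; inj₁; inj₂)
  open import Data.Empty using (⊥-elim)
  open import Data.Unit using (⊤; tt)
  open import Data.List as List using ([]; _∷_; allFin)
  open import Data.List.Membership.Propositional using (_∈_)
  open import Data.List.Membership.Propositional.Properties using (∈-++⁻; ∈-map⁻; ∈-concatMap⁻)
  open import Data.List.Relation.Unary.Any using (here; satisfied)
  open import Data.List.Relation.Unary.All using ([]; _∷_)
  open import Function using (_∘_; _∋_)
  open import Function.Definitions using (Injective)
  open import Relation.Nullary using (Dec; yes; no; ¬_)
  open import Relation.Nullary.Decidable using (_×-dec_; _⊎-dec_; ¬?)
  open import Relation.Unary using (Decidable)
  open import Relation.Binary.PropositionalEquality

  ι : Fin k → Fin r
  ι i = inject≤ i k≤r

  ι-injective : ∀ {i j} → ι i ≡ ι j → i ≡ j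
  ι-injective = inject≤-injective k≤r k≤r _ _

  xExp yExp : Mon r → Fin r → ℕ
  xExp m = lookup (proj₁ m)
  yExp m = lookup (proj₂ m)

  xMon yMon : Fin r → Mon r
  xMon t = unitVec t , replicate r 0
  yMon t = replicate r 0 , unitVec t

  lookup-unitVec-≡ : ∀ (t : Fin r) → lookup (unitVec t) t ≡ 1
  lookup-unitVec-≡ t rewrite (lookup (unitVec t) t ≡ _) ∋ VecP.lookup∘tabulate _ t with t ≟ t
  ... | yes _  = refl
  ... | no t≢t = ⊥-elim (t≢t refl)

  lookup-unitVec-≢ : ∀ {s t : Fin r} → s ≢ t → lookup (unitVec s) t ≡ 0
  lookup-unitVec-≢ {s} {t} s≢t rewrite (lookup (unitVec s) t ≡ _) ∋ VecP.lookup∘tabulate _ t with s ≟ t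
  ... | yes s≡t = ⊥-elim (s≢t s≡t)
  ... | no _    = refl

  xExp-monMul : ∀ m n t → xExp (monMul m n) t ≡ xExp m t ℕ.+ xExp n t
  xExp-monMul m n t = VecP.lookup-zipWith ℕ._+_ t (proj₁ m) (proj₁ n)

  yExp-monMul : ∀ m n t → yExp (monMul m n) t ≡ yExp m t ℕ.+ yExp n t
  yExp-monMul m n t = VecP.lookup-zipWith ℕ._+_ t (proj₂ m) (proj₂ n)

  xExp-monMul-≥ˡ : ∀ m n t → 1 ≤ xExp m t → 1 ≤ xExp (monMul m n) t
  xExp-monMul-≥ˡ m n t 1≤m = subst (1 ≤_) (sym (xExp-monMul m n t)) (ℕP.≤-trans 1≤m (ℕP.m≤m+n _ _))

  xExp-monMul-≥ʳ : ∀ m n t → 1 ≤ xExp n t → 1 ≤ xExp (monMul m n) t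
  xExp-monMul-≥ʳ m n t 1≤n = subst (1 ≤_) (sym (xExp-monMul m n t)) (ℕP.≤-trans 1≤n (ℕP.m≤n+m _ _))

  yExp-monMul-≥ˡ : ∀ m n t → 1 ≤ yExp m t → 1 ≤ yExp (monMul m n) t
  yExp-monMul-≥ˡ m n t 1≤m = subst (1 ≤_) (sym (yExp-monMul m n t)) (ℕP.≤-trans 1≤m (ℕP.m≤m+n _ _))

  yExp-monMul-≥ʳ : ∀ m n t → 1 ≤ yExp n t → 1 ≤ yExp (monMul m n) t
  yExp-monMul-≥ʳ m n t 1≤n = subst (1 ≤_) (sym (yExp-monMul m n t)) (ℕP.≤-trans 1≤n (ℕP.m≤n+m _ _))

  xExp-xMon : ∀ t → 1 ≤ xExp (xMon t) t
  xExp-xMon t = ℕP.≤-reflexive (sym (lookup-unitVec-≡ t))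

  yExp-yMon : ∀ t → 1 ≤ yExp (yMon t) t
  yExp-yMon t = ℕP.≤-reflexive (sym (lookup-unitVec-≡ t))

  DivisibleByXY : Mon r → Set
  DivisibleByXY m = Σ (Fin k) λ i → 1 ≤ xExp m (ι i) × 1 ≤ yExp m (ι i)

  HasOuterX : ∀ {n} → (Fin n → Fin k) → Mon r → Set
  HasOuterX ρ m = Σ (Fin k) λ j → (∀ l → ρ l ≢ j) × 1 ≤ xExp m (ι j)

  Reducible : ∀ {n} → (Fin n → Fin k) → Mon r → Set
  Reducible ρ m = DivisibleByXY m ⊎ HasOuterX ρ m

  rowYProduct : ∀ {n} → (Fin n → Fin k) → Mon r
  rowYProduct {zero}  ρ = mon1
  rowYProduct {suc n} ρ = monMul (yMon (ι (ρ Fin.zero))) (rowYProduct (ρ ∘ Fin.suc))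

  Admissible : ∀ {n} → (Fin n → Fin k) → Mon r → Set
  Admissible ρ m = Reducible ρ m ⊎ m ≡ rowYProduct ρ

  reducible? : ∀ {n} (ρ : Fin n → Fin k) → Decidable (Reducible ρ)
  reducible? ρ m =
    any? (λ i → (1 ≤? xExp m (ι i)) ×-dec (1 ≤? yExp m (ι i)))
    ⊎-dec any? (λ j → all? (λ l → ¬? (ρ l ≟ j)) ×-dec (1 ≤? xExp m (ι j)))

  admissible? : ∀ {n} (ρ : Fin n → Fin k) → Decidable (Admissible ρ)
  admissible? ρ m = reducible? ρ m ⊎-dec mon-dec m (rowYProduct ρ)

  reducible-monMul : ∀ {n} (ρ : Fin n → Fin k) m n → Reducible ρ m → Reducible ρ (monMul m n)
  reducible-monMul ρ m n (inj₁ (i , x , y))     = inj₁ (i , xExp-monMul-≥ˡ m n _ x , yExp-monMul-≥ˡ m n _ y)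
  reducible-monMul ρ m n (inj₂ (j , outer , x)) = inj₂ (j , outer , xExp-monMul-≥ˡ m n _ x)

  admissible-yMon : ∀ {n} (ρ : Fin (suc n) → Fin k) m →
                    Admissible (ρ ∘ Fin.suc) m → Admissible ρ (monMul (yMon (ι (ρ Fin.zero))) m)
  admissible-yMon ρ m (inj₁ (inj₁ (i , x , y))) =
    inj₁ (inj₁ (i , xExp-monMul-≥ʳ (yMon (ι (ρ Fin.zero))) m _ x , yExp-monMul-≥ʳ (yMon (ι (ρ Fin.zero))) m _ y))
  admissible-yMon ρ m (inj₁ (inj₂ (j , outer , x))) with ρ Fin.zero ≟ j
  ... | yes refl = inj₁ (inj₁ (j , xExp-monMul-≥ʳ (yMon (ι j)) m _ x , yExp-monMul-≥ˡ (yMon (ι j)) m _ (yExp-yMon (ι j))))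
  ... | no ρ₀≢j  = inj₁ (inj₂ (j , (λ { Fin.zero → ρ₀≢j ; (Fin.suc l) → outer l })
                                  , xExp-monMul-≥ʳ (yMon (ι (ρ Fin.zero))) m _ x))
  admissible-yMon ρ m (inj₂ m≡ρ′) = inj₂ (cong (monMul (yMon (ι (ρ Fin.zero)))) m≡ρ′)

  entry : Col k → Fin k → Poly r
  entry = colEntry k≤r

  Valid : Col k → Set
  Valid (ycol _)   = ⊤
  Valid (qcol i j) = i ≢ j

  submatrix : ∀ {n} → (Fin n → Fin k) → (Fin n → Col k) → Fin n → Fin n → Poly r
  submatrix ρ γ l j = entry (γ j) (ρ l)

  yPart xPart : Col k → Fin k → Poly r
  yPart (ycol i)   l = entry (ycol i) l
  yPart (qcol _ _) _ = zeroP
  xPart (ycol _)   _ = zeroP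
  xPart (qcol i j) l = entry (qcol i j) l

  entry-split : ∀ c l → entry c l ≈ yPart c l +P xPart c l
  entry-split (ycol i)   l = ≈-sym (+P-identityʳ _)
  entry-split (qcol i j) l = ≈-refl

  yPart-*P-vanishes : ∀ {n} (ρ : Fin (suc n) → Fin k) c {p} →
                      VanishesOutside (Admissible (ρ ∘ Fin.suc)) p →
                      VanishesOutside (Admissible ρ) (yPart c (ρ Fin.zero) *P p)
  yPart-*P-vanishes ρ (qcol _ _) vp = vanishing λ _ _ → refl
  yPart-*P-vanishes ρ (ycol i) {p} vp with i ≟ ρ Fin.zero
  ... | no _     = vanishing λ _ _ → refl
  ... | yes refl = vanishesOutside-*P (λ m → mon-dec m (yMon (ι i))) (admissible? (ρ ∘ Fin.suc))
                     (λ { m n refl → admissible-yMon ρ n }) {yVar (ι i)} {p}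
                     (supported⇒vanishesOutside (refl ∷ [])) vp

  NoY : Fin k → Mon r → Set
  NoY d m = yExp m (ι d) ≡ 0

  noY-closed : ∀ d m n → NoY d m → NoY d n → NoY d (monMul m n)
  noY-closed d m n m₀ n₀ = trans (yExp-monMul m n (ι d)) (cong₂ ℕ._+_ m₀ n₀)

  noY-one : ∀ d → NoY d mon1
  noY-one d = VecP.lookup-replicate (ι d) 0

  xPart-noY : ∀ d c l → SupportedIn (NoY d) (xPart c l)
  xPart-noY d (ycol _)   l = []
  xPart-noY d (qcol i j) l with l ≟ i | l ≟ j
  ... | yes _ | _     = noY-one d ∷ []
  ... | no _  | yes _ = noY-one d ∷ []
  ... | no _  | no _  = []

  entry-noY : ∀ d c {l} → l ≢ d → SupportedIn (NoY d) (entry c l)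
  entry-noY d (ycol i) {l} l≢d with i ≟ l
  ... | yes refl = lookup-unitVec-≢ (l≢d ∘ ι-injective) ∷ []
  ... | no _     = []
  entry-noY d (qcol i j) {l} _ = xPart-noY d (qcol i j) l

  yExp-xMon-monMul : ∀ s m t → yExp (monMul (xMon s) m) t ≡ yExp m t
  yExp-xMon-monMul s m t =
    trans (yExp-monMul (xMon s) m t) (cong (ℕ._+ yExp m t) (VecP.lookup-replicate t 0))

  xExp-xMon-monMul : ∀ {s t} m → s ≢ t → xExp (monMul (xMon s) m) t ≡ xExp m t
  xExp-xMon-monMul {s} {t} m s≢t =
    trans (xExp-monMul (xMon s) m t) (cong (ℕ._+ xExp m t) (lookup-unitVec-≢ s≢t))

  reducible-cancelX : ∀ {n} (ρ : Fin (suc n) → Fin k) m → NoY (ρ Fin.zero) m →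
                      Reducible ρ (monMul (xMon (ι (ρ Fin.zero))) m) → Reducible ρ m
  reducible-cancelX ρ m noY (inj₁ (i , x , y)) with i ≟ ρ Fin.zero
  ... | yes refl = ⊥-elim (ℕP.n≮0 (subst (1 ≤_) (trans (yExp-xMon-monMul (ι i) m (ι i)) noY) y))
  ... | no i≢d   = inj₁ (i , subst (1 ≤_) (xExp-xMon-monMul m (i≢d ∘ sym ∘ ι-injective)) x
                           , subst (1 ≤_) (yExp-xMon-monMul (ι (ρ Fin.zero)) m (ι i)) y)
  reducible-cancelX ρ m noY (inj₂ (j , outer , x)) =
    inj₂ (j , outer , subst (1 ≤_) (xExp-xMon-monMul m (outer Fin.zero ∘ ι-injective)) x)

  vanishesOutside-cancelX : ∀ {n} (ρ : Fin (suc n) → Fin k) {q} → SupportedIn (NoY (ρ Fin.zero)) q →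
                            VanishesOutside (Reducible ρ) (xVar (ι (ρ Fin.zero)) *P q) →
                            VanishesOutside (Reducible ρ) q
  vanishesOutside-cancelX ρ {q} noY-q xq-vanishes = vanishing coeff-q
    where
    d = ι (ρ Fin.zero)
    coeff-q : ∀ m → ¬ Reducible ρ m → coeff q m ≡ + 0
    coeff-q m ¬red with yExp m d ℕ.≟ 0
    ... | no  y≢0 = supported⇒coeff-outside noY-q m y≢0
    ... | yes y≡0 = trans (sym (coeff-monomial-*P (xMon d) q m))
                          (coeff-outside xq-vanishes (monMul (xMon d) m) (¬red ∘ reducible-cancelX ρ m y≡0))

  rowCombination-ycol : ∀ {n} (ρ : Fin n → Fin k) i →
                        SupportedIn DivisibleByXY (∑[ l < n ] (xVar (ι (ρ l)) *P entry (ycol i) (ρ l)))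
  rowCombination-ycol ρ i = supported-sum _ (xy-term ∘ ρ)
    where
    xy-term : ∀ t → SupportedIn DivisibleByXY (xVar (ι t) *P entry (ycol i) t)
    xy-term t with i ≟ t
    ... | no _     = []
    ... | yes refl = (i , xExp-monMul-≥ˡ (xMon (ι i)) (yMon (ι i)) (ι i) (xExp-xMon (ι i))
                        , yExp-monMul-≥ʳ (xMon (ι i)) (yMon (ι i)) (ι i) (yExp-yMon (ι i))) ∷ []

  scaledUnit : Fin k → Poly r → Fin k → Poly r
  scaledUnit i p t with t ≟ i
  ... | yes _ = p
  ... | no _  = zeroP

  scaledUnit-≡ : ∀ i p → scaledUnit i p i ≡ p
  scaledUnit-≡ i p with i ≟ i
  ... | yes _  = refl
  ... | no i≢i = ⊥-elim (i≢i refl)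

  scaledUnit-≢ : ∀ {i t} p → t ≢ i → scaledUnit i p t ≡ zeroP
  scaledUnit-≢ {i} {t} p t≢i with t ≟ i
  ... | yes t≡i = ⊥-elim (t≢i t≡i)
  ... | no _    = refl

  qcol-entry : ∀ {i j} → i ≢ j → ∀ t →
               entry (qcol i j) t ≈ scaledUnit i (negP (xVar (ι j))) t +P scaledUnit j (xVar (ι i)) t
  qcol-entry {i} {j} i≢j t with t ≟ i | t ≟ j
  ... | yes refl | yes refl = ⊥-elim (i≢j refl)
  ... | yes _    | no _     = ≈-sym (+P-identityʳ _)
  ... | no _     | yes _    = ≈-refl
  ... | no _     | no _     = ≈-refl

  rowCombination-qcol : ∀ {n} (ρ : Fin (suc n) → Fin k) → Injective _≡_ _≡_ ρ → ∀ {i j} → i ≢ j →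
                        VanishesOutside (Reducible ρ) (∑[ l < suc n ] (xVar (ι (ρ l)) *P entry (qcol i j) (ρ l)))
  rowCombination-qcol {n} ρ ρ-injective {i} {j} i≢j =
    vanishesOutside-cong (R.sym split) (cases (any? λ l → ρ l ≟ i) (any? λ l → ρ l ≟ j))
    where
    ψᵢ ψⱼ : Fin k → Poly r
    ψᵢ t = xVar (ι t) *P scaledUnit i (negP (xVar (ι j))) t
    ψⱼ t = xVar (ι t) *P scaledUnit j (xVar (ι i)) t
    Sᵢ Sⱼ xᵢ-xⱼ xⱼxᵢ : Poly r
    Sᵢ = ∑[ l < suc n ] ψᵢ (ρ l)
    Sⱼ = ∑[ l < suc n ] ψⱼ (ρ l)
    xᵢ-xⱼ = xVar (ι i) *P negP (xVar (ι j))
    xⱼxᵢ  = xVar (ι j) *P xVar (ι i)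

    split : ∑[ l < suc n ] (xVar (ι (ρ l)) *P entry (qcol i j) (ρ l)) ≈ Sᵢ +P Sⱼ
    split = R.trans (sum-cong-≋ term) (∑-distrib-+ (ψᵢ ∘ ρ) (ψⱼ ∘ ρ))
      where
      term : ∀ l → xVar (ι (ρ l)) *P entry (qcol i j) (ρ l) ≈ ψᵢ (ρ l) +P ψⱼ (ρ l)
      term l = R.trans (R.*-congˡ {xVar (ι (ρ l))} (qcol-entry i≢j (ρ l)))
                       (R.distribˡ (xVar (ι (ρ l))) (scaledUnit i (negP (xVar (ι j))) (ρ l))
                                                    (scaledUnit j (xVar (ι i)) (ρ l)))

    ψᵢ-single : ∀ t → t ≢ i → ψᵢ t ≈ zeroP
    ψᵢ-single t t≢i = R.reflexive (cong (xVar (ι t) *P_) (scaledUnit-≢ _ t≢i))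
    ψⱼ-single : ∀ t → t ≢ j → ψⱼ t ≈ zeroP
    ψⱼ-single t t≢j = R.reflexive (cong (xVar (ι t) *P_) (scaledUnit-≢ _ t≢j))

    Sᵢ-hit : ∀ {l} → ρ l ≡ i → Sᵢ ≈ xᵢ-xⱼ
    Sᵢ-hit ρl≡i = R.trans (∑-∘-hit ρ ψᵢ ψᵢ-single ρ-injective _ ρl≡i)
                          (R.reflexive (cong (xVar (ι i) *P_) (scaledUnit-≡ i _)))
    Sⱼ-hit : ∀ {l} → ρ l ≡ j → Sⱼ ≈ xⱼxᵢ
    Sⱼ-hit ρl≡j = R.trans (∑-∘-hit ρ ψⱼ ψⱼ-single ρ-injective _ ρl≡j)
                          (R.reflexive (cong (xVar (ι j) *P_) (scaledUnit-≡ j _)))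
    Sᵢ-missed : ¬ ∃ (λ l → ρ l ≡ i) → Sᵢ ≈ zeroP
    Sᵢ-missed missᵢ = ∑-∘-missed ρ ψᵢ ψᵢ-single λ l → missᵢ ∘ (l ,_)
    Sⱼ-missed : ¬ ∃ (λ l → ρ l ≡ j) → Sⱼ ≈ zeroP
    Sⱼ-missed missⱼ = ∑-∘-missed ρ ψⱼ ψⱼ-single λ l → missⱼ ∘ (l ,_)

    outer : ∀ a {b} → ¬ ∃ (λ l → ρ l ≡ b) → Reducible ρ (monMul (xMon (ι a)) (xMon (ι b)))
    outer a {b} miss =
      inj₂ (b , (λ l → miss ∘ (l ,_)) , xExp-monMul-≥ʳ (xMon (ι a)) (xMon (ι b)) (ι b) (xExp-xMon (ι b)))

    cancel : xᵢ-xⱼ +P xⱼxᵢ ≈ zeroP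
    cancel = R.trans (R.+-congʳ {xⱼxᵢ} xᵢ-xⱼ≈-xⱼxᵢ) (R.-‿inverseˡ xⱼxᵢ)
      where
      xᵢ-xⱼ≈-xⱼxᵢ : xᵢ-xⱼ ≈ negP xⱼxᵢ
      xᵢ-xⱼ≈-xⱼxᵢ = R.trans (R.sym (-‿distribʳ-* (xVar (ι i)) (xVar (ι j))))
                            (R.-‿cong {xVar (ι i) *P xVar (ι j)} {xⱼxᵢ} (R.*-comm (xVar (ι i)) (xVar (ι j))))

    cases : Dec (∃ λ l → ρ l ≡ i) → Dec (∃ λ l → ρ l ≡ j) → VanishesOutside (Reducible ρ) (Sᵢ +P Sⱼ)
    cases (yes (_ , hitᵢ)) (yes (_ , hitⱼ)) =
      vanishesOutside-cong (R.sym (R.trans (R.+-cong (Sᵢ-hit hitᵢ) (Sⱼ-hit hitⱼ)) cancel)) (vanishing λ _ _ → refl)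
    cases (yes (_ , hitᵢ)) (no missⱼ) =
      vanishesOutside-cong (R.sym (R.trans (R.+-cong (Sᵢ-hit hitᵢ) (Sⱼ-missed missⱼ)) (R.+-identityʳ _)))
        (supported⇒vanishesOutside (outer i missⱼ ∷ []))
    cases (no missᵢ) (yes (_ , hitⱼ)) =
      vanishesOutside-cong (R.sym (R.trans (R.+-cong (Sᵢ-missed missᵢ) (Sⱼ-hit hitⱼ)) (R.+-identityˡ _)))
        (supported⇒vanishesOutside (outer j missᵢ ∷ []))
    cases (no missᵢ) (no missⱼ) =
      vanishesOutside-cong (R.sym (R.trans (R.+-cong (Sᵢ-missed missᵢ) (Sⱼ-missed missⱼ)) (R.+-identityˡ _)))
        (vanishing λ _ _ → refl)

  module _ {n} (ρ : Fin (suc n) → Fin k) (ρ-injective : Injective _≡_ _≡_ ρ)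
               (γ : Fin (suc n) → Col k) (valid : ∀ j → Valid (γ j)) where

    private
      d : Fin k
      d = ρ Fin.zero
      rest : Fin n → Fin (suc n) → Poly r
      rest l j = entry (γ j) (ρ (Fin.suc l))
      xRow : Fin (suc n) → Poly r
      xRow j = xPart (γ j) d
      combinedRow : Fin (suc n) → Poly r
      combinedRow j = (xVar (ι d) *P xRow j) +P (∑[ l < n ] (xVar (ι (ρ (Fin.suc l))) *P rest l j))

    combinedRow-vanishes : ∀ j → VanishesOutside (Reducible ρ) (combinedRow j)
    combinedRow-vanishes j with γ j | valid j
    ... | ycol i   | _   =
      vanishesOutside-mono (λ _ → inj₁) (supported⇒vanishesOutside (rowCombination-ycol (ρ ∘ Fin.suc) i))
    ... | qcol a b | a≢b = rowCombination-qcol ρ ρ-injective a≢b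

    xExpansion-vanishes : VanishesOutside (Reducible ρ) (expand xRow rest)
    xExpansion-vanishes =
      vanishesOutside-cancelX ρ xExpansion-noY (vanishesOutside-cong (R.sym x*expansion) expansion-vanishes)
      where
      xExpansion-noY : SupportedIn (NoY d) (expand xRow rest)
      xExpansion-noY = supported-expand (noY-closed d) (noY-one d) (λ j → xPart-noY d (γ j) d)
        (λ l j → entry-noY d (γ j) (λ ρsl≡d → 0≢1+n (ρ-injective (sym ρsl≡d))))
      x*expansion : xVar (ι d) *P expand xRow rest ≈ expand combinedRow rest
      x*expansion = R.trans (R.sym (expand-*ˡ rest (xVar (ι d)) xRow))
                            (R.sym (expand-addRows rest (xVar ∘ ι ∘ ρ ∘ Fin.suc) (λ j → xVar (ι d) *P xRow j)))
      expansion-vanishes : VanishesOutside (Reducible ρ) (expand combinedRow rest)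
      expansion-vanishes = vanishesOutside-sum _ λ j →
        vanishesOutside-*P-ideal (reducible? ρ) (reducible-monMul ρ) (cofactor rest j) (combinedRow-vanishes j)

  minor-vanishesOutside : ∀ n (ρ : Fin n → Fin k) → Injective _≡_ _≡_ ρ →
                          (γ : Fin n → Col k) → (∀ j → Valid (γ j)) →
                          VanishesOutside (Admissible ρ) (det n (submatrix ρ γ))
  minor-vanishesOutside zero    ρ _           γ _     = supported⇒vanishesOutside (inj₂ refl ∷ [])
  minor-vanishesOutside (suc n) ρ ρ-injective γ valid =
    vanishesOutside-cong (R.sym firstRow-split)
      (vanishesOutside-++ (vanishesOutside-sum _ yTerm-vanishes)
                          (vanishesOutside-mono (λ _ → inj₁) (xExpansion-vanishes ρ ρ-injective γ valid)))
    where
    rest : Fin n → Fin (suc n) → Poly r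
    rest l j = entry (γ j) (ρ (Fin.suc l))
    yRow xRow : Fin (suc n) → Poly r
    yRow j = yPart (γ j) (ρ Fin.zero)
    xRow j = xPart (γ j) (ρ Fin.zero)
    firstRow-split : det (suc n) (submatrix ρ γ) ≈ expand yRow rest +P expand xRow rest
    firstRow-split = R.trans (expand-congˡ rest (λ j → entry-split (γ j) (ρ Fin.zero))) (expand-+ rest yRow xRow)
    yTerm-vanishes : ∀ j → VanishesOutside (Admissible ρ) (yRow j *P cofactor rest j)
    yTerm-vanishes j = yPart-*P-vanishes ρ (γ j) (vanishesOutside-sign (toℕ j)
      (minor-vanishesOutside n (ρ ∘ Fin.suc) (suc-injective ∘ ρ-injective) (γ ∘ punchIn j) (valid ∘ punchIn j)))

  proj₁-rowYProduct : ∀ {n} (ρ : Fin n → Fin k) → proj₁ (rowYProduct ρ) ≡ replicate r 0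
  proj₁-rowYProduct {zero}  ρ = refl
  proj₁-rowYProduct {suc n} ρ =
    trans (cong (zipWith ℕ._+_ (replicate r 0)) (proj₁-rowYProduct (ρ ∘ Fin.suc)))
          (VecP.zipWith-identityˡ ℕP.+-identityˡ _)

  yExp-rowYProduct-missed : ∀ {n} (ρ : Fin n → Fin k) {t} → (∀ l → ι (ρ l) ≢ t) → yExp (rowYProduct ρ) t ≡ 0
  yExp-rowYProduct-missed {zero}  ρ {t} missed = VecP.lookup-replicate t 0
  yExp-rowYProduct-missed {suc n} ρ {t} missed =
    trans (yExp-monMul (yMon (ι (ρ Fin.zero))) (rowYProduct (ρ ∘ Fin.suc)) t)
          (cong₂ ℕ._+_ (lookup-unitVec-≢ (missed Fin.zero))
                       (yExp-rowYProduct-missed (ρ ∘ Fin.suc) (missed ∘ Fin.suc)))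

  yExp-rowYProduct-hit : ∀ {n} (ρ : Fin n → Fin k) → Injective _≡_ _≡_ ρ → ∀ {l t} → ι (ρ l) ≡ t →
                         yExp (rowYProduct ρ) t ≡ 1
  yExp-rowYProduct-hit {suc n} ρ ρ-injective {l} {t} ρl≡t =
    trans (yExp-monMul (yMon (ι (ρ Fin.zero))) (rowYProduct (ρ ∘ Fin.suc)) t) (hit l ρl≡t)
    where
    hit : ∀ l → ι (ρ l) ≡ t → lookup (unitVec (ι (ρ Fin.zero))) t ℕ.+ yExp (rowYProduct (ρ ∘ Fin.suc)) t ≡ 1
    hit Fin.zero    refl = cong₂ ℕ._+_ (lookup-unitVec-≡ t)
      (yExp-rowYProduct-missed (ρ ∘ Fin.suc) λ l ρsl≡t → 0≢1+n (ρ-injective (ι-injective (sym ρsl≡t))))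
    hit (Fin.suc l) ρsl≡t = cong₂ ℕ._+_
      (lookup-unitVec-≢ λ ρ₀≡t → 0≢1+n (ρ-injective (ι-injective (trans ρ₀≡t (sym ρsl≡t)))))
      (yExp-rowYProduct-hit (ρ ∘ Fin.suc) (suc-injective ∘ ρ-injective) ρsl≡t)

  rowYProduct-all : rowYProduct (λ (l : Fin k) → l) ≡ yProd k k≤r
  rowYProduct-all = cong₂ _,_ (proj₁-rowYProduct (λ l → l)) (vec-ext yExp-all)
    where
    vec-ext : ∀ {u v : Vec ℕ r} → (∀ t → lookup u t ≡ lookup v t) → u ≡ v
    vec-ext {u} {v} u≗v =
      trans (sym (VecP.tabulate∘lookup u)) (trans (VecP.tabulate-cong u≗v) (VecP.tabulate∘lookup v))
    yExp-all : ∀ t → yExp (rowYProduct (λ l → l)) t ≡ lookup (proj₂ (yProd k k≤r)) t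
    yExp-all t rewrite (lookup (proj₂ (yProd k k≤r)) t ≡ _) ∋ VecP.lookup∘tabulate _ t with toℕ t ℕ.<? k
    ... | yes t<k = yExp-rowYProduct-hit (λ l → l) (λ l≡l′ → l≡l′)
                      (toℕ-injective (trans (toℕ-inject≤ (Fin.fromℕ< t<k) k≤r) (toℕ-fromℕ< t<k)))
    ... | no t≮k  = yExp-rowYProduct-missed (λ l → l) λ l ιl≡t →
                      t≮k (subst (ℕ._< k) (trans (sym (toℕ-inject≤ l k≤r)) (cong toℕ ιl≡t)) (toℕ<n l))

  cols-valid : ∀ {c} → c ∈ cols k → Valid c
  cols-valid c∈ with ∈-++⁻ (List.map ycol (allFin k)) c∈
  ... | inj₁ c∈ycols with ∈-map⁻ ycol c∈ycols
  ...   | _ , _ , refl = tt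
  cols-valid c∈ | inj₂ c∈qcols with satisfied (∈-concatMap⁻ _ {xs = allFin k} c∈qcols)
  ... | i , c∈qcolsᵢ with satisfied (∈-concatMap⁻ _ {xs = allFin k} c∈qcolsᵢ)
  ...   | j , c∈qcolsᵢⱼ with i Fin.<? j
  ...     | yes i<j with c∈qcolsᵢⱼ
  ...       | here refl = <⇒≢ i<j
  cols-valid c∈ | inj₂ c∈qcols | i , c∈qcolsᵢ | j , c∈qcolsᵢⱼ | no _ with c∈qcolsᵢⱼ
  ... | ()

  fullMinor-monomials : (γ : Fin k → Col k) → (∀ j → Valid (γ j)) →
                        ∀ m → coeff (Defs.det k (submatrix (λ l → l) γ)) m ≢ + 0 →
                        m ≡ yProd k k≤r ⊎ DivisibleByXY m
  fullMinor-monomials γ valid m coeff≢0 with admissible? (λ l → l) m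
  ... | yes (inj₁ (inj₁ divisible))       = inj₂ divisible
  ... | yes (inj₁ (inj₂ (j , outer , _))) = ⊥-elim (outer j refl)
  ... | yes (inj₂ m≡rowYProduct)          = inj₁ (trans m≡rowYProduct rowYProduct-all)
  ... | no ¬admissible                    = ⊥-elim (coeff≢0 (trans (coeff-cong (Defs-det≈det k _) m)
        (coeff-outside (minor-vanishesOutside k (λ l → l) (λ l≡l′ → l≡l′) γ valid) m ¬admissible)))

open import Defs
open import Data.Integer using (+_)
open import Data.Vec using (lookup)
import Data.List as List
open import Data.List.Membership.Propositional.Properties using (∈-lookup)
open import Data.Product using (Σ; _×_; proj₁; proj₂)
open import Data.Sum using (_⊎_)
open import Relation.Binary.PropositionalEquality using (_≡_; _≢_)

lemmaA6 : (r k : ℕ) → 1 ≤ k → (k≤r : k ≤ r)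
          → (c : Fin k → Fin (N k)) → (∀ a b → a < b → c a < c b)
          → (m : Mon r) → coeff (minor k k≤r c) m ≢ + 0
          → m ≡ yProd k k≤r
            ⊎ Σ (Fin k) (λ i → 1 ≤ lookup (proj₁ m) (inject≤ i k≤r) × 1 ≤ lookup (proj₂ m) (inject≤ i k≤r))
lemmaA6 r k _ k≤r c _ = fullMinor-monomials γ (λ j → cols-valid (∈-lookup (c j)))
  where
  open Minors k≤r using (fullMinor-monomials; cols-valid)
  γ : Fin k → Col k
  γ j = List.lookup (cols k) (c j)
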